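{- Let $d$ be a degree sequence and let $\mathcal{P}(d)$ be the subgraph of the realization graph $\mathcal{G}(d)$ induced by the pseudoforests with degree sequence $d$. Then $\mathcal{P}(d)$ is connected; i.e., any two pseudoforests on $\{1,\dots,n\}$ with the same degree sequence can be transformed into one another by a sequence of 2-switches all of whose intermediate graphs are pseudoforests.
   Context: All graphs are finite and simple. A pseudoforest is a graph each of whose connected components is a tree or a unicyclic graph (connected with exactly one cycle). A 2-switch on $G$ is specified by four distinct vertices $a,b,c,d$ with $ab,cd\in E(G)$ and $ac,bd\notin E(G)$; it produces $G-ab-cd+ac+bd$. The realization graph $\mathcal{G}(d)$ has as vertices all graphs on $\{1,\dots,n\}$ with degree sequence $d$, adjacent when one is obtained from the other by a single 2-switch. -}

module Defs where

open import Data.Nat using (ℕ; _≤_)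
open import Data.Bool using (Bool; true; false; if_then_else_; T)
open import Data.Fin using (Fin)
open import Data.List using (List; []; _∷_; length; map; allFin; last)
open import Data.Nat.ListAction using (sum)
open import Data.List.Relation.Unary.Unique.Propositional using (Unique)
open import Data.List.Membership.Propositional using (_∈_)
open import Data.Maybe using (just)
open import Data.Product using (Σ; ∃; _×_; _,_; ∃-syntax)
open import Data.Sum using (_⊎_)
open import Relation.Nullary using (¬_)
open import Relation.Binary.PropositionalEquality using (_≡_; _≢_)
open import Relation.Binary.Construct.Closure.ReflexiveTransitive using (Star)

-- A finite simple graph on the vertex set Fin n = {0,…,n-1}
-- (standing for {1,…,n}), given by a symmetric irreflexive adjacency function.
record Graph (n : ℕ) : Set where
  field
    adj     : Fin n → Fin n → Bool
    adj-sym : ∀ x y → adj x y ≡ adj y x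
    adj-irr : ∀ x → adj x x ≡ false
open Graph public

Edge : ∀ {n} → Graph n → Fin n → Fin n → Set
Edge G x y = T (adj G x y)

deg : ∀ {n} → Graph n → Fin n → ℕ
deg {n} G v = sum (map (λ u → if adj G v u then 1 else 0) (allFin n))

SameDegrees : ∀ {n} → Graph n → Graph n → Set
SameDegrees {n} G H = ∀ (v : Fin n) → deg G v ≡ deg H v

data IsPath {n} (G : Graph n) : List (Fin n) → Set where
  nil   : IsPath G []
  one   : ∀ x → IsPath G (x ∷ [])
  cons  : ∀ x y vs → Edge G x y → IsPath G (y ∷ vs) → IsPath G (x ∷ y ∷ vs)

record Cycle {n} (G : Graph n) : Set where
  field
    verts   : List (Fin n)
    long    : 3 ≤ length verts
    distinct : Unique verts
    path    : IsPath G verts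
    closing : ∀ first rest lst → verts ≡ first ∷ rest → last verts ≡ just lst → Edge G lst first
open Cycle public

data ConsecIn {n} : List (Fin n) → Fin n → Fin n → Set where
  here  : ∀ x y vs → ConsecIn (x ∷ y ∷ vs) x y
  there : ∀ x vs a b → ConsecIn vs a b → ConsecIn (x ∷ vs) a b

CycleEdge : ∀ {n} {G : Graph n} → Cycle G → Fin n → Fin n → Set
CycleEdge C a b =
  (ConsecIn (verts C) a b ⊎ ConsecIn (verts C) b a)
  ⊎ (∃[ f ] ∃[ l ] ((∃[ r ] verts C ≡ f ∷ r) × last (verts C) ≡ just l
                   × ((a ≡ l × b ≡ f) ⊎ (a ≡ f × b ≡ l))))

-- Two cycles are the same cycle (same subgraph) iff they have the same edge set.
SameCycle : ∀ {n} {G : Graph n} → Cycle G → Cycle G → Set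
SameCycle {n} C D = ∀ (a b : Fin n) → (CycleEdge C a b → CycleEdge D a b) × (CycleEdge D a b → CycleEdge C a b)

Connected : ∀ {n} → Graph n → Fin n → Fin n → Set
Connected G = Star (Edge G)

-- Pseudoforest: every connected component is a tree or unicyclic, i.e. every
-- component contains at most one cycle: any two cycles lying in the same
-- component coincide.
Pseudoforest : ∀ {n} → Graph n → Set
Pseudoforest {n} G =
  ∀ (C D : Cycle G) (x y : Fin n) → x ∈ verts C → y ∈ verts D → Connected G x y → SameCycle C D

Pair : ∀ {n} → Fin n → Fin n → Fin n → Fin n → Set
Pair x y u v = (x ≡ u × y ≡ v) ⊎ (x ≡ v × y ≡ u)

TwoSwitch : ∀ {n} → Graph n → Graph n → Set
TwoSwitch {n} G H =
  Σ (Fin n) λ a → Σ (Fin n) λ b → Σ (Fin n) λ c → Σ (Fin n) λ d →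
    (a ≢ b × a ≢ c × a ≢ d × b ≢ c × b ≢ d × c ≢ d)
    × Edge G a b × Edge G c d × ¬ Edge G a c × ¬ Edge G b d
    × (∀ x y → (Edge H x y →
                  ((Edge G x y × ¬ Pair x y a b × ¬ Pair x y c d) ⊎ Pair x y a c ⊎ Pair x y b d))
             × (((Edge G x y × ¬ Pair x y a b × ¬ Pair x y c d) ⊎ Pair x y a c ⊎ Pair x y b d)
                  → Edge H x y))

-- Adjacency in the induced subgraph P(d) of the realization graph: a 2-switch
-- between two pseudoforests (degree sequence is automatically preserved).
PStep : ∀ {n} → Graph n → Graph n → Set
PStep G H = Pseudoforest G × Pseudoforest H × TwoSwitch G H

SameGraph : ∀ {n} → Graph n → Graph n → Set
SameGraph {n} G H = ∀ (x y : Fin n) → adj G x y ≡ adj H x y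

{-# OPTIONS --safe #-}
-- Induction on the number of non-isolated vertices. If G has a leaf v, let w ≠ v have maximum degree.
-- At most one P-step in G, and one in H, makes v a pendant vertex at w: this is a 2-switch {vu, wx} → {vw, ux}
-- for a neighbour x of w, and when deg w ≥ 3 the three neighbours of w cannot all spoil it, since a pseudoforest
-- has at most one cycle per component. Deleting vw from both graphs gives smaller pseudoforests with equal
-- degrees, and P-steps between them lift back once the pendant edge is re-added. If G has no leaf it has
-- maximum degree 2; then switches preserving that bound give a degree-2 vertex v its two neighbours in H,
-- and both edges are deleted. The walk from H is reversed at the end.

module Submission where

open import Data.Bool using (Bool; true; false; if_then_else_; T; not; _∧_)
open import Data.Bool.Properties using (∧-identityʳ)
open import Data.Empty using (⊥; ⊥-elim)
open import Data.Fin using (Fin; zero; suc)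
open import Data.Fin.Properties using (_≟_; all?; any?)
import Data.Fin.Properties as Finₚ
open import Data.List using (List; []; _∷_; _++_; length; map; tabulate; allFin; last; filter)
open import Data.List.Membership.Propositional using (_∈_; _∉_)
open import Data.List.Membership.Propositional.Properties using (∈-++⁺ˡ; ∈-++⁺ʳ; ∈-∃++; ∈-allFin; ∈-filter⁺)
open import Data.List.Properties using (∷-injectiveˡ; length-++; length-tabulate; ++-assoc; ∷ʳ-injective)
open import Data.List.Relation.Unary.All as All using (All; []; _∷_; lookup)
open import Data.List.Relation.Unary.All.Properties using (¬Any⇒All¬; all-filter)
open import Data.List.Relation.Unary.AllPairs using ([]; _∷_)
open import Data.List.Relation.Unary.Any using (here; there)
import Data.List.Relation.Unary.Any as Any
open import Data.List.Relation.Unary.Unique.Propositional using (Unique)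
open import Data.List.Relation.Unary.Unique.Propositional.Properties using (Unique[x∷xs]⇒x∉xs)
import Data.List.Relation.Unary.Unique.DecPropositional as UniqueDec
open import Data.Maybe using (just)
open import Data.Maybe.Properties using (just-injective)
open import Data.Nat using (ℕ; zero; suc; _+_; _≤_; _<_; z≤n; s≤s; _≤?_)
open import Data.Nat.ListAction using (sum)
open import Data.Nat.Properties
  using (+-suc; +-identityʳ; ≤-trans; ≤-refl; ≤-reflexive; ≤-pred; n≤1+n; m≤n+m; <-irrefl; ≤-<-trans; suc-injective; ≰⇒>; ≤-totalOrder)
  renaming (_≟_ to _≟ℕ_)
open import Data.List.Extrema ≤-totalOrder using (argmax; argmax-all; f[xs]≤f[argmax])
open import Data.Product using (Σ; ∃-syntax; _×_; _,_; proj₁; proj₂)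
open import Data.Sum using (_⊎_; inj₁; inj₂; [_,_]′)
open import Data.Unit using (tt)
open import Function using (_∘_; mk⇔)
open import Relation.Binary.Construct.Closure.ReflexiveTransitive using (Star; ε; _◅_; _◅◅_)
import Relation.Binary.Construct.Closure.ReflexiveTransitive as Closure
open import Relation.Binary.PropositionalEquality using (_≡_; _≢_; refl; sym; trans; cong; subst; subst₂; ≢-sym; module ≡-Reasoning)
open import Relation.Nullary using (¬_; Dec; yes; no; does; ¬?)
open import Relation.Nullary.Decidable using (map′; _×-dec_; _⊎-dec_; _→-dec_; does-⇔; T?)

open import Defs

-- Counting and degrees

indicator : Bool → ℕ
indicator b = if b then 1 else 0

count : ∀ {n} → (Fin n → Bool) → ℕ
count {zero}  f = 0
count {suc n} f = indicator (f zero) + count (f ∘ suc)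

count-cong : ∀ {n} {f g : Fin n → Bool} → (∀ i → f i ≡ g i) → count f ≡ count g
count-cong {zero}  f≗g = refl
count-cong {suc n} {g = g} f≗g rewrite f≗g zero = cong (indicator (g zero) +_) (count-cong (f≗g ∘ suc))

count-insert : ∀ {n} {f g : Fin n → Bool} i → ¬ T (f i) → T (g i) → (∀ j → j ≢ i → f j ≡ g j) →
               count g ≡ suc (count f)
count-insert {suc n} {f} {g} zero fi gi f≗g with f zero | g zero
... | false | true = cong suc (count-cong (λ j → sym (f≗g (suc j) λ ())))
... | true  | _    = ⊥-elim (fi tt)
count-insert {suc n} {f} {g} (suc i) fi gi f≗g rewrite f≗g zero (λ ()) =
  trans (cong (indicator (g zero) +_) (count-insert i fi gi (λ j j≢i → f≗g (suc j) (j≢i ∘ Finₚ.suc-injective))))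
        (+-suc _ _)

count-zero : ∀ {n} (f : Fin n → Bool) → count f ≡ 0 → ∀ i → ¬ T (f i)
count-zero {suc n} f eq i with f zero in fz
count-zero {suc n} f eq zero    | false = subst (¬_ ∘ T) (sym fz) λ ()
count-zero {suc n} f eq (suc i) | false = count-zero (f ∘ suc) eq i

count-mono : ∀ {n} {f g : Fin n → Bool} → (∀ i → T (f i) → T (g i)) → count f ≤ count g
count-mono {zero}  f⊆g = z≤n
count-mono {suc n} {f} {g} f⊆g with f zero in fz | g zero in gz
... | false | false = count-mono (f⊆g ∘ suc)
... | false | true  = ≤-trans (count-mono (f⊆g ∘ suc)) (n≤1+n _)
... | true  | true  = s≤s (count-mono (f⊆g ∘ suc))
... | true  | false = ⊥-elim (subst T gz (f⊆g zero (subst T (sym fz) tt)))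

clear : ∀ {n} → Fin n → (Fin n → Bool) → (Fin n → Bool)
clear i f j = f j ∧ not (does (j ≟ i))

T-clear : ∀ {n} (f : Fin n → Bool) {i j} → T (clear i f j) → T (f j) × j ≢ i
T-clear f {i} {j} t with f j | j ≟ i
... | true | no j≢i = tt , j≢i

clear-≢ : ∀ {n} (f : Fin n → Bool) {i j} → j ≢ i → clear i f j ≡ f j
clear-≢ f {i} {j} j≢i with f j | j ≟ i
... | b     | no _    = ∧-identityʳ b
... | _     | yes j≡i = ⊥-elim (j≢i j≡i)

count≤suc-clear : ∀ {n} (f : Fin n → Bool) i → count f ≤ suc (count (clear i f))
count≤suc-clear f i with f i in fi
... | true  = ≤-reflexive (count-insert {f = clear i f} i (λ t → proj₂ (T-clear f t) refl) (subst T (sym fi) tt) λ j → clear-≢ f)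
... | false = ≤-trans (count-mono {f = f} {g = clear i f} (λ j t → subst T (sym (clear-≢ f (j≢i j t))) t)) (n≤1+n _)
  where
  j≢i : ∀ j → T (f j) → j ≢ i
  j≢i j t refl = subst T fi t

count-pos : ∀ {n} (f : Fin n → Bool) → 1 ≤ count f → ∃[ i ] T (f i)
count-pos {suc n} f pos with f zero in fz
... | true  = zero , subst T (sym fz) tt
... | false = let i , t = count-pos (f ∘ suc) pos in suc i , t

count-≥-length : ∀ {n} (f : Fin n → Bool) {xs} → Unique xs → All (T ∘ f) xs → length xs ≤ count f
count-≥-length f []        []          = z≤n
count-≥-length f {x ∷ xs} (x∉xs ∷ u) (fx ∷ fxs) =
  ≤-trans (s≤s (count-≥-length (clear x f) u (All.zipWith keep (x∉xs , fxs))))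
          (≤-reflexive (sym (count-insert {f = clear x f} x (λ t → proj₂ (T-clear f t) refl) fx λ j → clear-≢ f)))
  where
  keep : ∀ {y} → x ≢ y × T (f y) → T (clear x f y)
  keep (x≢y , t) = subst T (sym (clear-≢ f (≢-sym x≢y))) t

count-fresh : ∀ {n} (f : Fin n → Bool) xs → length xs < count f → ∃[ i ] (T (f i) × i ∉ xs)
count-fresh f []       lt = let i , t = count-pos f lt in i , t , λ ()
count-fresh f (x ∷ xs) lt with count-fresh (clear x f) xs (≤-pred (≤-trans lt (count≤suc-clear f x)))
... | i , t , i∉xs = i , proj₁ (T-clear f t) , λ { (here refl) → proj₂ (T-clear f t) refl ; (there m) → i∉xs m }

count-< : ∀ {n} {f g : Fin n → Bool} i → (∀ j → T (f j) → T (g j)) → ¬ T (f i) → T (g i) → count f < count g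
count-< {f = f} {g} i f⊆g ¬fi gi =
  ≤-trans (s≤s (count-mono {f = f} {clear i g} keep)) (≤-reflexive (sym (count-insert {f = clear i g} i (λ t → proj₂ (T-clear g t) refl) gi λ j → clear-≢ g)))
  where
  keep : ∀ j → T (f j) → T (clear i g j)
  keep j t = subst T (sym (clear-≢ g λ { refl → ¬fi t })) (f⊆g j t)

sum-indicator-tabulate : ∀ {n m} (g : Fin n → Fin m) (h : Fin m → Bool) →
                         sum (map (indicator ∘ h) (tabulate g)) ≡ count (h ∘ g)
sum-indicator-tabulate {zero}  g h = refl
sum-indicator-tabulate {suc n} g h = cong (indicator (h (g zero)) +_) (sum-indicator-tabulate (g ∘ suc) h)

deg≡count : ∀ {n} (G : Graph n) v → deg G v ≡ count (adj G v)
deg≡count G v = sum-indicator-tabulate (λ u → u) (adj G v)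

edge-sym : ∀ {n} (G : Graph n) {x y} → Edge G x y → Edge G y x
edge-sym G {x} {y} = subst T (adj-sym G x y)

edge-irrefl : ∀ {n} (G : Graph n) {x} → ¬ Edge G x x
edge-irrefl G {x} = subst T (adj-irr G x)

edge⇒≢ : ∀ {n} (G : Graph n) {x y} → Edge G x y → x ≢ y
edge⇒≢ G e refl = edge-irrefl G e

deg-≥-length : ∀ {n} (G : Graph n) {v xs} → Unique xs → All (Edge G v) xs → length xs ≤ deg G v
deg-≥-length G {v} u es = subst (_ ≤_) (sym (deg≡count G v)) (count-≥-length (adj G v) u es)

deg-fresh : ∀ {n} (G : Graph n) {v} xs → length xs < deg G v → ∃[ u ] (Edge G v u × u ∉ xs)
deg-fresh G {v} xs lt = count-fresh (adj G v) xs (subst (_ <_) (deg≡count G v) lt)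

deg-zero : ∀ {n} (G : Graph n) {v x} → deg G v ≡ 0 → ¬ Edge G v x
deg-zero G {v} {x} d = count-zero (adj G v) (trans (sym (deg≡count G v)) d) x

edge⇒deg-pos : ∀ {n} (G : Graph n) {v x} → Edge G v x → 1 ≤ deg G v
edge⇒deg-pos G e = deg-≥-length G ([] ∷ []) (e ∷ [])

deg-pos⇒edge : ∀ {n} (G : Graph n) {v} → 1 ≤ deg G v → ∃[ x ] Edge G v x
deg-pos⇒edge G d = let x , e , _ = deg-fresh G [] d in x , e

deg≥2⇒other-edge : ∀ {n} (G : Graph n) {v p} → 2 ≤ deg G v → Edge G v p → ∃[ x ] (Edge G v x × x ≢ p)
deg≥2⇒other-edge G d _ = let x , e , x∉ = deg-fresh G (_ ∷ []) d in x , e , x∉ ∘ here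

deg≥3⇒three-edges : ∀ {n} (G : Graph n) {v} → 3 ≤ deg G v →
  ∃[ x ] ∃[ y ] ∃[ z ] (Edge G v x × Edge G v y × Edge G v z × x ≢ y × x ≢ z × y ≢ z)
deg≥3⇒three-edges G d with deg-pos⇒edge G (≤-trans (s≤s z≤n) d)
... | x , ex with deg≥2⇒other-edge G (≤-trans (s≤s (s≤s z≤n)) d) ex
... | y , ey , y≢x with deg-fresh G (x ∷ y ∷ []) d
... | z , ez , z∉ = x , y , z , ex , ey , ez , ≢-sym y≢x , (λ x≡z → z∉ (here (sym x≡z))) , (λ y≡z → z∉ (there (here (sym y≡z))))

deg≤2⇒third-edge : ∀ {n} (G : Graph n) {v x y z} → deg G v ≤ 2 → Edge G v x → Edge G v y → x ≢ y → Edge G v z → z ≡ x ⊎ z ≡ y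
deg≤2⇒third-edge G {z = z} d ex ey x≢y ez with z ≟ _ | z ≟ _
... | yes z≡x | _       = inj₁ z≡x
... | no _    | yes z≡y = inj₂ z≡y
... | no z≢x  | no z≢y  = ⊥-elim (3≰2 (≤-trans (deg-≥-length G u (ex ∷ ey ∷ ez ∷ [])) d))
  where
  u : Unique (_ ∷ _ ∷ z ∷ [])
  u = (x≢y ∷ ≢-sym z≢x ∷ []) ∷ (≢-sym z≢y ∷ []) ∷ [] ∷ []
  3≰2 : ¬ 3 ≤ 2
  3≰2 (s≤s (s≤s ()))

deg≤1⇒unique-edge : ∀ {n} (G : Graph n) {v x y} → deg G v ≤ 1 → Edge G v x → Edge G v y → x ≡ y
deg≤1⇒unique-edge G {x = x} {y} d ex ey with x ≟ y
... | yes x≡y = x≡y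
... | no x≢y  = ⊥-elim (2≰1 (≤-trans (deg-≥-length G ((x≢y ∷ []) ∷ [] ∷ []) (ex ∷ ey ∷ [])) d))
  where
  2≰1 : ¬ 2 ≤ 1
  2≰1 (s≤s ())

-- Adding and removing edges

-- Opaque, so that `with pair? x y a b` can abstract it in goals about removeEdge and addEdge.
opaque
  pair? : ∀ {n} (x y a b : Fin n) → Dec (Pair x y a b)
  pair? x y a b = ((x ≟ a) ×-dec (y ≟ b)) ⊎-dec ((x ≟ b) ×-dec (y ≟ a))

pair-refl : ∀ {n} {a b : Fin n} → Pair a b a b
pair-refl = inj₁ (refl , refl)

pair-sym : ∀ {n} {x y a b : Fin n} → Pair x y a b → Pair y x a b
pair-sym (inj₁ (p , q)) = inj₂ (q , p)
pair-sym (inj₂ (p , q)) = inj₁ (q , p)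

pair-flip : ∀ {n} {x y a b : Fin n} → Pair x y a b → Pair x y b a
pair-flip (inj₁ (p , q)) = inj₂ (p , q)
pair-flip (inj₂ (p , q)) = inj₁ (p , q)

pair-swap : ∀ {n} {x y a b : Fin n} → Pair x y a b → Pair a b x y
pair-swap (inj₁ (refl , refl)) = inj₁ (refl , refl)
pair-swap (inj₂ (refl , refl)) = inj₂ (refl , refl)

pair-irrefl : ∀ {n} {x a b : Fin n} → a ≢ b → ¬ Pair x x a b
pair-irrefl a≢b (inj₁ (refl , refl)) = a≢b refl
pair-irrefl a≢b (inj₂ (refl , refl)) = a≢b refl

pair-avoid : ∀ {n} {x y a b : Fin n} → x ≢ a → x ≢ b → ¬ Pair x y a b
pair-avoid x≢a x≢b (inj₁ (x≡a , _)) = x≢a x≡a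
pair-avoid x≢a x≢b (inj₂ (x≡b , _)) = x≢b x≡b

pair-apart : ∀ {n} {x y v w a b : Fin n} → v ≢ a → v ≢ b → Pair x y v w → ¬ Pair x y a b
pair-apart v≢a v≢b (inj₁ (refl , refl)) q = pair-avoid v≢a v≢b q
pair-apart v≢a v≢b (inj₂ (refl , refl)) q = pair-avoid v≢a v≢b (pair-sym q)

pair-other : ∀ {n} {x y z a b : Fin n} → a ≢ b → Pair x y a b → Pair x z a b → z ≡ y
pair-other a≢b (inj₁ (refl , refl)) (inj₁ (_ , refl)) = refl
pair-other a≢b (inj₂ (refl , refl)) (inj₂ (_ , refl)) = refl
pair-other a≢b (inj₁ (refl , refl)) (inj₂ (refl , _)) = ⊥-elim (a≢b refl)
pair-other a≢b (inj₂ (refl , refl)) (inj₁ (refl , _)) = ⊥-elim (a≢b refl)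

pair-edge : ∀ {n} (G : Graph n) {x y a b} → Pair x y a b → Edge G a b → Edge G x y
pair-edge G (inj₁ (refl , refl)) e = e
pair-edge G (inj₂ (refl , refl)) e = edge-sym G e

does-pair-sym : ∀ {n} (x y a b : Fin n) → does (pair? x y a b) ≡ does (pair? y x a b)
does-pair-sym x y a b = does-⇔ (mk⇔ pair-sym pair-sym) (pair? x y a b) (pair? y x a b)

removeEdge : ∀ {n} → Graph n → Fin n → Fin n → Graph n
adj (removeEdge G a b) x y = if does (pair? x y a b) then false else adj G x y
adj-sym (removeEdge G a b) x y rewrite does-pair-sym x y a b | adj-sym G x y = refl
adj-irr (removeEdge G a b) x with pair? x x a b
... | yes _ = refl
... | no _  = adj-irr G x

addEdge : ∀ {n} → Graph n → (a b : Fin n) → a ≢ b → Graph n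
adj (addEdge G a b a≢b) x y = if does (pair? x y a b) then true else adj G x y
adj-sym (addEdge G a b a≢b) x y rewrite does-pair-sym x y a b | adj-sym G x y = refl
adj-irr (addEdge G a b a≢b) x with pair? x x a b
... | yes p = ⊥-elim (pair-irrefl a≢b p)
... | no _  = adj-irr G x

module _ {n} (G : Graph n) (a b : Fin n) {x y : Fin n} where

  removeEdge⁻ : Edge (removeEdge G a b) x y → Edge G x y × ¬ Pair x y a b
  removeEdge⁻ e with pair? x y a b
  ... | no ¬p = e , ¬p

  removeEdge⁺ : Edge G x y → ¬ Pair x y a b → Edge (removeEdge G a b) x y
  removeEdge⁺ e ¬p with pair? x y a b
  ... | yes p = ⊥-elim (¬p p)
  ... | no _  = e

  removeEdge-⊆ : Edge (removeEdge G a b) x y → Edge G x y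
  removeEdge-⊆ = proj₁ ∘ removeEdge⁻

  module _ (a≢b : a ≢ b) where

    addEdge⁻ : Edge (addEdge G a b a≢b) x y → Edge G x y ⊎ Pair x y a b
    addEdge⁻ e with pair? x y a b
    ... | yes p = inj₂ p
    ... | no _  = inj₁ e

    addEdge⁺ˡ : Edge G x y → Edge (addEdge G a b a≢b) x y
    addEdge⁺ˡ e with pair? x y a b
    ... | yes _ = tt
    ... | no _  = e

    addEdge⁺ʳ : Pair x y a b → Edge (addEdge G a b a≢b) x y
    addEdge⁺ʳ p with pair? x y a b
    ... | yes _ = tt
    ... | no ¬p = ⊥-elim (¬p p)

T-ext : ∀ {p q : Bool} → (T p → T q) → (T q → T p) → p ≡ q
T-ext {true}  {true}  _ _ = refl
T-ext {true}  {false} f _ = ⊥-elim (f tt)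
T-ext {false} {true}  _ g = ⊥-elim (g tt)
T-ext {false} {false} _ _ = refl

-- SameGraph wrapped in a record, so that Agda can infer the two graphs from it.
infix 4 _≅_
record _≅_ {n} (G H : Graph n) : Set where
  constructor mk≅
  field same-adj : SameGraph G H
open _≅_ public

≅-intro : ∀ {n} {G H : Graph n} → (∀ {x y} → Edge G x y → Edge H x y) → (∀ {x y} → Edge H x y → Edge G x y) → G ≅ H
≅-intro G⊆H H⊆G = mk≅ λ x y → T-ext G⊆H H⊆G

≅-refl : ∀ {n} {G : Graph n} → G ≅ G
≅-refl = mk≅ λ x y → refl

≅-sym : ∀ {n} {G H : Graph n} → G ≅ H → H ≅ G
≅-sym (mk≅ G≈H) = mk≅ λ x y → sym (G≈H x y)

≅-trans : ∀ {n} {G H K : Graph n} → G ≅ H → H ≅ K → G ≅ K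
≅-trans (mk≅ G≈H) (mk≅ H≈K) = mk≅ λ x y → trans (G≈H x y) (H≈K x y)

≅-edge : ∀ {n} {G H : Graph n} → G ≅ H → ∀ {x y} → Edge G x y → Edge H x y
≅-edge (mk≅ G≈H) {x} {y} = subst T (G≈H x y)

deg-same-row : ∀ {n} (G H : Graph n) {v} → (∀ {j} → Edge G v j → Edge H v j) → (∀ {j} → Edge H v j → Edge G v j) → deg G v ≡ deg H v
deg-same-row G H {v} G⊆H H⊆G = trans (deg≡count G v) (trans (count-cong {f = adj G v} {adj H v} λ j → T-ext G⊆H H⊆G) (sym (deg≡count H v)))

deg-insert : ∀ {n} (G H : Graph n) {v} w → ¬ Edge G v w → Edge H v w →
             (∀ {j} → j ≢ w → Edge G v j → Edge H v j) → (∀ {j} → j ≢ w → Edge H v j → Edge G v j) → deg H v ≡ suc (deg G v)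
deg-insert G H {v} w ¬Gw Hw G⊆H H⊆G =
  trans (deg≡count H v) (trans (count-insert w ¬Gw Hw λ j j≢w → T-ext (G⊆H j≢w) (H⊆G j≢w)) (cong suc (sym (deg≡count G v))))

≅⇒sameDegrees : ∀ {n} {G H : Graph n} → G ≅ H → SameDegrees G H
≅⇒sameDegrees {G = G} {H} G≅H v = deg-same-row G H (≅-edge G≅H) (≅-edge (≅-sym G≅H))

deg-removeEdge-end : ∀ {n} (G : Graph n) {a b v w} → Pair v w a b → Edge G a b → deg G v ≡ suc (deg (removeEdge G a b) v)
deg-removeEdge-end G {a} {b} p e =
  deg-insert (removeEdge G a b) G _ (λ e′ → proj₂ (removeEdge⁻ G a b e′) p) (pair-edge G p e)
    (λ _ → removeEdge-⊆ G a b) (λ j≢w e′ → removeEdge⁺ G a b e′ (j≢w ∘ pair-other (edge⇒≢ G e) p))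

deg-removeEdge-other : ∀ {n} (G : Graph n) {a b v} → v ≢ a → v ≢ b → deg (removeEdge G a b) v ≡ deg G v
deg-removeEdge-other G {a} {b} v≢a v≢b = deg-same-row (removeEdge G a b) G (removeEdge-⊆ G a b) (λ e → removeEdge⁺ G a b e (pair-avoid v≢a v≢b))

deg-addEdge-end : ∀ {n} (G : Graph n) {a b v w} (a≢b : a ≢ b) → Pair v w a b → ¬ Edge G a b → deg (addEdge G a b a≢b) v ≡ suc (deg G v)
deg-addEdge-end G {a} {b} a≢b p ¬e =
  deg-insert G (addEdge G a b a≢b) _ (¬e ∘ pair-edge G (pair-swap p)) (addEdge⁺ʳ G a b a≢b p)
    (λ _ → addEdge⁺ˡ G a b a≢b) (λ j≢w e → [ (λ e′ → e′) , (λ q → ⊥-elim (j≢w (pair-other a≢b p q))) ]′ (addEdge⁻ G a b a≢b e))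

deg-addEdge-other : ∀ {n} (G : Graph n) {a b v} (a≢b : a ≢ b) → v ≢ a → v ≢ b → deg (addEdge G a b a≢b) v ≡ deg G v
deg-addEdge-other G {a} {b} a≢b v≢a v≢b =
  deg-same-row (addEdge G a b a≢b) G (λ e → [ (λ e′ → e′) , (λ q → ⊥-elim (pair-avoid v≢a v≢b q)) ]′ (addEdge⁻ G a b a≢b e))
    (addEdge⁺ˡ G a b a≢b)

-- Two-switches

Distinct4 : ∀ {n} → (a b c d : Fin n) → Set
Distinct4 a b c d = a ≢ b × a ≢ c × a ≢ d × b ≢ c × b ≢ d × c ≢ d

SwitchEdge : ∀ {n} → Graph n → (a b c d x y : Fin n) → Set
SwitchEdge G a b c d x y = (Edge G x y × ¬ Pair x y a b × ¬ Pair x y c d) ⊎ Pair x y a c ⊎ Pair x y b d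

-- TwoSwitch G H is by definition Σ a b c d, TwoSwitchAt G H a b c d.
TwoSwitchAt : ∀ {n} → Graph n → Graph n → (a b c d : Fin n) → Set
TwoSwitchAt G H a b c d = Distinct4 a b c d
    × Edge G a b × Edge G c d × ¬ Edge G a c × ¬ Edge G b d
    × (∀ x y → (Edge H x y → SwitchEdge G a b c d x y) × (SwitchEdge G a b c d x y → Edge H x y))

switch : ∀ {n} → Graph n → (a b c d : Fin n) → a ≢ c → b ≢ d → Graph n
switch G a b c d a≢c b≢d = addEdge (addEdge (removeEdge (removeEdge G a b) c d) b d b≢d) a c a≢c

module _ {n} (G : Graph n) (a b c d : Fin n) (a≢c : a ≢ c) (b≢d : b ≢ d) where

  private
    R₁ R₂ A₁ : Graph n
    R₁ = removeEdge G a b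
    R₂ = removeEdge R₁ c d
    A₁ = addEdge R₂ b d b≢d

  switch⁻ : ∀ {x y} → Edge (switch G a b c d a≢c b≢d) x y → SwitchEdge G a b c d x y
  switch⁻ e with addEdge⁻ A₁ a c a≢c e
  ... | inj₂ p = inj₂ (inj₁ p)
  ... | inj₁ e₁ with addEdge⁻ R₂ b d b≢d e₁
  ... | inj₂ p = inj₂ (inj₂ p)
  ... | inj₁ e₂ with removeEdge⁻ R₁ c d e₂
  ... | e₃ , ¬cd with removeEdge⁻ G a b e₃
  ... | e₄ , ¬ab = inj₁ (e₄ , ¬ab , ¬cd)

  switch⁺ : ∀ {x y} → SwitchEdge G a b c d x y → Edge (switch G a b c d a≢c b≢d) x y
  switch⁺ (inj₁ (e , ¬ab , ¬cd)) =
    addEdge⁺ˡ A₁ a c a≢c (addEdge⁺ˡ R₂ b d b≢d (removeEdge⁺ R₁ c d (removeEdge⁺ G a b e ¬ab) ¬cd))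
  switch⁺ (inj₂ (inj₁ p)) = addEdge⁺ʳ A₁ a c a≢c p
  switch⁺ (inj₂ (inj₂ p)) = addEdge⁺ˡ A₁ a c a≢c (addEdge⁺ʳ R₂ b d b≢d p)

  switch-sameDegrees : Distinct4 a b c d → Edge G a b → Edge G c d → ¬ Edge G a c → ¬ Edge G b d →
                       SameDegrees G (switch G a b c d a≢c b≢d)
  switch-sameDegrees (a≢b , _ , a≢d , b≢c , _ , c≢d) eab ecd ¬ac ¬bd = degree-at
    where
    open ≡-Reasoning
    ecd₁ : Edge R₁ c d
    ecd₁ = removeEdge⁺ G a b ecd (pair-avoid (≢-sym a≢c) (≢-sym b≢c))
    ¬R₂bd : ¬ Edge R₂ b d
    ¬R₂bd = ¬bd ∘ removeEdge-⊆ G a b ∘ removeEdge-⊆ R₁ c d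
    ¬A₁ac : ¬ Edge A₁ a c
    ¬A₁ac e with addEdge⁻ R₂ b d b≢d e
    ... | inj₁ e′ = ¬ac (removeEdge-⊆ G a b (removeEdge-⊆ R₁ c d e′))
    ... | inj₂ p = pair-avoid a≢b a≢d p
    degree-at : ∀ z → deg G z ≡ deg (switch G a b c d a≢c b≢d) z
    degree-at z with z ≟ a | z ≟ b | z ≟ c | z ≟ d
    ... | yes refl | _ | _ | _ = begin
      deg G a                 ≡⟨ deg-removeEdge-end G pair-refl eab ⟩
      suc (deg R₁ a)          ≡⟨ cong suc (sym (deg-removeEdge-other R₁ a≢c a≢d)) ⟩
      suc (deg R₂ a)          ≡⟨ cong suc (sym (deg-addEdge-other R₂ b≢d a≢b a≢d)) ⟩
      suc (deg A₁ a)          ≡⟨ sym (deg-addEdge-end A₁ a≢c pair-refl ¬A₁ac) ⟩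
      deg (switch G a b c d a≢c b≢d) a ∎
    ... | no _ | yes refl | _ | _ = begin
      deg G b                 ≡⟨ deg-removeEdge-end G (pair-sym pair-refl) eab ⟩
      suc (deg R₁ b)          ≡⟨ cong suc (sym (deg-removeEdge-other R₁ b≢c b≢d)) ⟩
      suc (deg R₂ b)          ≡⟨ sym (deg-addEdge-end R₂ b≢d pair-refl ¬R₂bd) ⟩
      deg A₁ b                ≡⟨ sym (deg-addEdge-other A₁ a≢c (≢-sym a≢b) b≢c) ⟩
      deg (switch G a b c d a≢c b≢d) b ∎
    ... | no _ | no _ | yes refl | _ = begin
      deg G c                 ≡⟨ sym (deg-removeEdge-other G (≢-sym a≢c) (≢-sym b≢c)) ⟩
      deg R₁ c                ≡⟨ deg-removeEdge-end R₁ pair-refl ecd₁ ⟩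
      suc (deg R₂ c)          ≡⟨ cong suc (sym (deg-addEdge-other R₂ b≢d (≢-sym b≢c) c≢d)) ⟩
      suc (deg A₁ c)          ≡⟨ sym (deg-addEdge-end A₁ a≢c (pair-sym pair-refl) ¬A₁ac) ⟩
      deg (switch G a b c d a≢c b≢d) c ∎
    ... | no _ | no _ | no _ | yes refl = begin
      deg G d                 ≡⟨ sym (deg-removeEdge-other G (≢-sym a≢d) (≢-sym b≢d)) ⟩
      deg R₁ d                ≡⟨ deg-removeEdge-end R₁ (pair-sym pair-refl) ecd₁ ⟩
      suc (deg R₂ d)          ≡⟨ sym (deg-addEdge-end R₂ b≢d (pair-sym pair-refl) ¬R₂bd) ⟩
      deg A₁ d                ≡⟨ sym (deg-addEdge-other A₁ a≢c (≢-sym a≢d) (≢-sym c≢d)) ⟩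
      deg (switch G a b c d a≢c b≢d) d ∎
    ... | no z≢a | no z≢b | no z≢c | no z≢d = begin
      deg G z                 ≡⟨ sym (deg-removeEdge-other G z≢a z≢b) ⟩
      deg R₁ z                ≡⟨ sym (deg-removeEdge-other R₁ z≢c z≢d) ⟩
      deg R₂ z                ≡⟨ sym (deg-addEdge-other R₂ b≢d z≢b z≢d) ⟩
      deg A₁ z                ≡⟨ sym (deg-addEdge-other A₁ a≢c z≢a z≢c) ⟩
      deg (switch G a b c d a≢c b≢d) z ∎

switch-twoSwitchAt : ∀ {n} {G : Graph n} {a b c d} (D : Distinct4 a b c d) → let (_ , a≢c , _ , _ , b≢d , _) = D in
  Edge G a b → Edge G c d → ¬ Edge G a c → ¬ Edge G b d → TwoSwitchAt G (switch G a b c d a≢c b≢d) a b c d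
switch-twoSwitchAt {G = G} {a} {b} {c} {d} D@(_ , a≢c , _ , _ , b≢d , _) eab ecd ¬ac ¬bd =
  D , eab , ecd , ¬ac , ¬bd , λ x y → switch⁻ G a b c d a≢c b≢d , switch⁺ G a b c d a≢c b≢d

twoSwitchAt⇒≅ : ∀ {n} {G H : Graph n} {a b c d} (t : TwoSwitchAt G H a b c d) → let ((_ , a≢c , _ , _ , b≢d , _) , _) = t in
  H ≅ switch G a b c d a≢c b≢d
twoSwitchAt⇒≅ {G = G} {a = a} {b} {c} {d} ((_ , a≢c , _ , _ , b≢d , _) , _ , _ , _ , _ , char) =
  ≅-intro (switch⁺ G a b c d a≢c b≢d ∘ proj₁ (char _ _)) (proj₂ (char _ _) ∘ switch⁻ G a b c d a≢c b≢d)

twoSwitch⇒sameDegrees : ∀ {n} {G H : Graph n} → TwoSwitch G H → SameDegrees G H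
twoSwitch⇒sameDegrees {G = G} {H} (a , b , c , d , t@(D@(_ , a≢c , _ , _ , b≢d , _) , eab , ecd , ¬ac , ¬bd , _)) z =
  trans (switch-sameDegrees G a b c d a≢c b≢d D eab ecd ¬ac ¬bd z)
        (sym (≅⇒sameDegrees (twoSwitchAt⇒≅ {G = G} {H} t) z))

twoSwitchAt-sym : ∀ {n} {G H : Graph n} {a b c d} → TwoSwitchAt G H a b c d → TwoSwitchAt H G a c b d
twoSwitchAt-sym {G = G} {H} {a} {b} {c} {d} ((a≢b , a≢c , a≢d , b≢c , b≢d , c≢d) , eab , ecd , ¬ac , ¬bd , char) =
  (a≢c , a≢b , a≢d , ≢-sym b≢c , c≢d , b≢d) , eac , ebd , ¬ab , ¬cd , λ x y → to , from
  where
  eac : Edge H a c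
  eac = proj₂ (char a c) (inj₂ (inj₁ pair-refl))
  ebd : Edge H b d
  ebd = proj₂ (char b d) (inj₂ (inj₂ pair-refl))
  ¬ab : ¬ Edge H a b
  ¬ab e with proj₁ (char a b) e
  ... | inj₁ (_ , ¬p , _) = ¬p pair-refl
  ... | inj₂ (inj₁ p) = b≢c (pair-other a≢c pair-refl p)
  ... | inj₂ (inj₂ p) = pair-avoid a≢b a≢d p
  ¬cd : ¬ Edge H c d
  ¬cd e with proj₁ (char c d) e
  ... | inj₁ (_ , _ , ¬p) = ¬p pair-refl
  ... | inj₂ (inj₁ p) = a≢d (sym (pair-other a≢c (pair-sym pair-refl) p))
  ... | inj₂ (inj₂ p) = pair-avoid (≢-sym b≢c) c≢d p
  to : ∀ {x y} → Edge G x y → SwitchEdge H a c b d x y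
  to {x} {y} e with pair? x y a b | pair? x y c d
  ... | yes p | _     = inj₂ (inj₁ p)
  ... | no _  | yes p = inj₂ (inj₂ p)
  ... | no ¬p | no ¬q = inj₁ (proj₂ (char x y) (inj₁ (e , ¬p , ¬q)) , ¬ac ∘ swapped , ¬bd ∘ swapped)
    where
    swapped : ∀ {s t} → Pair x y s t → Edge G s t
    swapped p = pair-edge G (pair-swap p) e
  from : ∀ {x y} → SwitchEdge H a c b d x y → Edge G x y
  from {x} {y} (inj₁ (e , ¬p , ¬q)) with proj₁ (char x y) e
  ... | inj₁ (e′ , _ , _) = e′
  ... | inj₂ (inj₁ p) = ⊥-elim (¬p p)
  ... | inj₂ (inj₂ q) = ⊥-elim (¬q q)
  from (inj₂ (inj₁ p)) = pair-edge G p eab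
  from (inj₂ (inj₂ p)) = pair-edge G p ecd

twoSwitch-sym : ∀ {n} {G H : Graph n} → TwoSwitch G H → TwoSwitch H G
twoSwitch-sym {G = G} {H} (a , b , c , d , t) = a , c , b , d , twoSwitchAt-sym {G = G} {H} t

twoSwitchAt-cong : ∀ {n} {G G′ H H′ : Graph n} {a b c d} → G ≅ G′ → H ≅ H′ →
                   TwoSwitchAt G H a b c d → TwoSwitchAt G′ H′ a b c d
twoSwitchAt-cong {G = G} {G′} {H} {H′} {a} {b} {c} {d} G≈G′ H≈H′ (D , eab , ecd , ¬ac , ¬bd , char) =
  D , toG′ eab , toG′ ecd , ¬ac ∘ toG , ¬bd ∘ toG , λ x y → to x y , from x y
  where
  toG′ : ∀ {x y} → Edge G x y → Edge G′ x y
  toG′ = ≅-edge G≈G′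
  toG : ∀ {x y} → Edge G′ x y → Edge G x y
  toG = ≅-edge (≅-sym G≈G′)
  to : ∀ x y → Edge H′ x y → SwitchEdge G′ a b c d x y
  to x y e with proj₁ (char x y) (≅-edge (≅-sym H≈H′) e)
  ... | inj₁ (e′ , ¬p , ¬q) = inj₁ (toG′ e′ , ¬p , ¬q)
  ... | inj₂ p = inj₂ p
  from : ∀ x y → SwitchEdge G′ a b c d x y → Edge H′ x y
  from x y (inj₁ (e , ¬p , ¬q)) = ≅-edge H≈H′ (proj₂ (char x y) (inj₁ (toG e , ¬p , ¬q)))
  from x y (inj₂ p) = ≅-edge H≈H′ (proj₂ (char x y) (inj₂ p))

twoSwitch-cong : ∀ {n} {G G′ H H′ : Graph n} → G ≅ G′ → H ≅ H′ → TwoSwitch G H → TwoSwitch G′ H′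
twoSwitch-cong G≈G′ H≈H′ (a , b , c , d , t) = a , b , c , d , twoSwitchAt-cong G≈G′ H≈H′ t

record TwoSwitchAvoiding {n} (v : Fin n) (G H : Graph n) : Set where
  constructor avoiding
  field
    {a b c d} : Fin n
    switchAt  : TwoSwitchAt G H a b c d
    avoids    : v ≢ a × v ≢ b × v ≢ c × v ≢ d

twoSwitchAvoiding⇒twoSwitch : ∀ {n} {v} {G H : Graph n} → TwoSwitchAvoiding v G H → TwoSwitch G H
twoSwitchAvoiding⇒twoSwitch (avoiding t _) = _ , _ , _ , _ , t

twoSwitch-avoids-isolated : ∀ {n} {v} {G H : Graph n} → deg G v ≡ 0 → TwoSwitch G H → TwoSwitchAvoiding v G H
twoSwitch-avoids-isolated {G = G} d0 (a , b , c , d , t@(_ , eab , ecd , _)) =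
  avoiding t (off eab , off (edge-sym G eab) , off ecd , off (edge-sym G ecd))
  where
  off : ∀ {x y} → Edge G x y → _ ≢ x
  off e refl = deg-zero G d0 e

twoSwitchAvoiding-addEdge : ∀ {n} {v} {G H : Graph n} → TwoSwitchAvoiding v G H → ∀ w (v≢w : v ≢ w) →
                            TwoSwitchAvoiding v (addEdge G v w v≢w) (addEdge H v w v≢w)
twoSwitchAvoiding-addEdge {v = v} {G} {H} (avoiding {a} {b} {c} {d} (D , eab , ecd , ¬ac , ¬bd , char) (v≢a , v≢b , v≢c , v≢d)) w v≢w =
  avoiding (D , G⁺ eab , G⁺ ecd , ¬new v≢a v≢c ¬ac , ¬new v≢b v≢d ¬bd , λ x y → to , from) (v≢a , v≢b , v≢c , v≢d)
  where
  G⁺ : ∀ {x y} → Edge G x y → Edge (addEdge G v w v≢w) x y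
  G⁺ = addEdge⁺ˡ G v w v≢w
  ¬new : ∀ {s t} → v ≢ s → v ≢ t → ¬ Edge G s t → ¬ Edge (addEdge G v w v≢w) s t
  ¬new v≢s v≢t ¬st e with addEdge⁻ G v w v≢w e
  ... | inj₁ e′ = ¬st e′
  ... | inj₂ p = pair-avoid v≢s v≢t (pair-swap p)
  to : ∀ {x y} → Edge (addEdge H v w v≢w) x y → SwitchEdge (addEdge G v w v≢w) a b c d x y
  to {x} {y} e with addEdge⁻ H v w v≢w e
  ... | inj₂ p = inj₁ (addEdge⁺ʳ G v w v≢w p , pair-apart v≢a v≢b p , pair-apart v≢c v≢d p)
  ... | inj₁ e′ with proj₁ (char x y) e′
  ... | inj₁ (eG , ¬p , ¬q) = inj₁ (G⁺ eG , ¬p , ¬q)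
  ... | inj₂ p = inj₂ p
  from : ∀ {x y} → SwitchEdge (addEdge G v w v≢w) a b c d x y → Edge (addEdge H v w v≢w) x y
  from {x} {y} (inj₁ (e , ¬p , ¬q)) with addEdge⁻ G v w v≢w e
  ... | inj₁ eG = addEdge⁺ˡ H v w v≢w (proj₂ (char x y) (inj₁ (eG , ¬p , ¬q)))
  ... | inj₂ p = addEdge⁺ʳ H v w v≢w p
  from {x} {y} (inj₂ p) = addEdge⁺ˡ H v w v≢w (proj₂ (char x y) (inj₂ p))

-- Cycles

last-∈ : ∀ {A : Set} (xs : List A) {l} → last xs ≡ just l → l ∈ xs
last-∈ (x ∷ [])     refl = here refl
last-∈ (x ∷ y ∷ xs) e    = there (last-∈ (y ∷ xs) e)

last-++ : ∀ {A : Set} (xs : List A) y ys → last (xs ++ y ∷ ys) ≡ last (y ∷ ys)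
last-++ []           y ys = refl
last-++ (x ∷ [])     y ys = refl
last-++ (x ∷ x′ ∷ xs) y ys = last-++ (x′ ∷ xs) y ys

last-∷ʳ : ∀ {A : Set} (xs : List A) y → last (xs ++ y ∷ []) ≡ just y
last-∷ʳ xs y = last-++ xs y []

last-∷ : ∀ {A : Set} (x : A) xs → ∃[ l ] last (x ∷ xs) ≡ just l
last-∷ x []       = x , refl
last-∷ x (y ∷ ys) = last-∷ y ys

unique-∷ : ∀ {A : Set} {x : A} {xs} → x ∉ xs → Unique xs → Unique (x ∷ xs)
unique-∷ x∉xs u = ¬Any⇒All¬ _ x∉xs ∷ u

unique-tail : ∀ {A : Set} {x : A} {xs} → Unique (x ∷ xs) → Unique xs
unique-tail (_ ∷ u) = u

unique-++ʳ : ∀ {A : Set} (xs : List A) {ys} → Unique (xs ++ ys) → Unique ys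
unique-++ʳ []       u = u
unique-++ʳ (_ ∷ xs) u = unique-++ʳ xs (unique-tail u)

unique-++ˡ : ∀ {A : Set} (xs : List A) {ys} → Unique (xs ++ ys) → Unique xs
unique-++ˡ []       u = []
unique-++ˡ (x ∷ xs) {ys} u = unique-∷ (Unique[x∷xs]⇒x∉xs u ∘ ∈-++⁺ˡ) (unique-++ˡ xs (unique-tail u))

unique-++-disjoint : ∀ {A : Set} (xs : List A) {ys x} → Unique (xs ++ ys) → x ∈ xs → x ∉ ys
unique-++-disjoint (y ∷ xs) u (here refl) = Unique[x∷xs]⇒x∉xs u ∘ ∈-++⁺ʳ xs
unique-++-disjoint (y ∷ xs) u (there m)   = unique-++-disjoint xs (unique-tail u) m

consecIn-∈ˡ : ∀ {n} {L : List (Fin n)} {a b} → ConsecIn L a b → a ∈ L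
consecIn-∈ˡ (here x y vs)       = here refl
consecIn-∈ˡ (there x vs a b c) = there (consecIn-∈ˡ c)

consecIn-∈-tail : ∀ {n} {x : Fin n} {xs a b} → ConsecIn (x ∷ xs) a b → b ∈ xs
consecIn-∈-tail (here x y vs)                = here refl
consecIn-∈-tail (there x (y ∷ vs) a b c) = there (consecIn-∈-tail c)

consecIn-∈ʳ : ∀ {n} {L : List (Fin n)} {a b} → ConsecIn L a b → b ∈ L
consecIn-∈ʳ {L = x ∷ xs} = there ∘ consecIn-∈-tail

consecIn-++⁺ˡ : ∀ {n} {xs : List (Fin n)} ys {a b} → ConsecIn xs a b → ConsecIn (xs ++ ys) a b
consecIn-++⁺ˡ ys (here x y vs)       = here x y (vs ++ ys)
consecIn-++⁺ˡ ys (there x vs a b c) = there x (vs ++ ys) a b (consecIn-++⁺ˡ ys c)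

consecIn-++⁺ʳ : ∀ {n} (xs : List (Fin n)) {ys a b} → ConsecIn ys a b → ConsecIn (xs ++ ys) a b
consecIn-++⁺ʳ []       c = c
consecIn-++⁺ʳ (x ∷ xs) c = there x _ _ _ (consecIn-++⁺ʳ xs c)

consecIn-split : ∀ {n} {L : List (Fin n)} {a b} → ConsecIn L a b → ∃[ pre ] ∃[ post ] (L ≡ pre ++ a ∷ b ∷ post)
consecIn-split (here x y vs) = [] , vs , refl
consecIn-split (there x vs a b c) with consecIn-split c
... | pre , post , refl = x ∷ pre , post , refl

consecIn-pred-unique : ∀ {n} {L : List (Fin n)} {a a′ b} → Unique L → ConsecIn L a b → ConsecIn L a′ b → a ≡ a′
consecIn-pred-unique u (here x y vs)             (here _ _ _)       = refl
consecIn-pred-unique u (here x y vs)             (there _ _ _ _ c) = ⊥-elim (Unique[x∷xs]⇒x∉xs (unique-tail u) (consecIn-∈-tail c))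
consecIn-pred-unique u (there x (y ∷ vs) a b c) (here _ _ _)       = ⊥-elim (Unique[x∷xs]⇒x∉xs (unique-tail u) (consecIn-∈-tail c))
consecIn-pred-unique u (there x vs a b c)        (there _ _ _ _ c′) = consecIn-pred-unique (unique-tail u) c c′

consecIn-asym : ∀ {n} {L : List (Fin n)} {a b} → Unique L → ConsecIn L a b → ¬ ConsecIn L b a
consecIn-asym u (here x y vs)             (here _ _ _)       = Unique[x∷xs]⇒x∉xs u (here refl)
consecIn-asym u (here x y vs)             (there _ _ _ _ c) = Unique[x∷xs]⇒x∉xs u (there (consecIn-∈-tail c))
consecIn-asym u (there x (y ∷ vs) a b c) (here _ _ _)       = Unique[x∷xs]⇒x∉xs u (there (consecIn-∈-tail c))
consecIn-asym u (there x vs a b c)        (there _ _ _ _ c′) = consecIn-asym (unique-tail u) c c′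

consecIn-last : ∀ {n} {L : List (Fin n)} {a b} → Unique L → last L ≡ just a → ¬ ConsecIn L a b
consecIn-last {L = x ∷ y ∷ vs} u e (here _ _ _)       = Unique[x∷xs]⇒x∉xs u (last-∈ (y ∷ vs) e)
consecIn-last {L = x ∷ y ∷ vs} u e (there _ _ _ _ c) = consecIn-last (unique-tail u) e c

consecIn-head-succ : ∀ {n} {f : Fin n} {r b} → Unique (f ∷ r) → ConsecIn (f ∷ r) f b → ∃[ r′ ] (r ≡ b ∷ r′)
consecIn-head-succ u (here x y vs)       = vs , refl
consecIn-head-succ u (there x vs a b c) = ⊥-elim (Unique[x∷xs]⇒x∉xs u (consecIn-∈ˡ c))

consecIn-head-last : ∀ {n} {f : Fin n} {r l} → Unique (f ∷ r) → last (f ∷ r) ≡ just l → ConsecIn (f ∷ r) f l → r ≡ l ∷ []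
consecIn-head-last u e c with consecIn-head-succ u c
... | []     , refl = refl
... | z ∷ zs , refl = ⊥-elim (Unique[x∷xs]⇒x∉xs (unique-tail u) (last-∈ (z ∷ zs) e))

succ-or-last : ∀ {n} {L : List (Fin n)} {x} → x ∈ L → (∃[ s ] ConsecIn L x s) ⊎ last L ≡ just x
succ-or-last {L = y ∷ []}     (here refl) = inj₂ refl
succ-or-last {L = y ∷ z ∷ zs} (here refl) = inj₁ (z , here y z zs)
succ-or-last {L = y ∷ z ∷ zs} (there m) with succ-or-last m
... | inj₁ (s , c) = inj₁ (s , there y (z ∷ zs) _ s c)
... | inj₂ e       = inj₂ e

pred-or-head : ∀ {n} {f : Fin n} {r x} → x ∈ f ∷ r → (∃[ p ] ConsecIn (f ∷ r) p x) ⊎ x ≡ f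
pred-or-head (here refl) = inj₂ refl
pred-or-head {f = f} {r = z ∷ zs} (there m) with pred-or-head m
... | inj₁ (p , c) = inj₁ (p , there f (z ∷ zs) p _ c)
... | inj₂ refl    = inj₁ (f , here f z zs)

-- CycleEdge C is CycleEdgeIn (verts C), stated for lists so that it is decidable.
CycleEdgeIn : ∀ {n} → List (Fin n) → Fin n → Fin n → Set
CycleEdgeIn L a b =
  (ConsecIn L a b ⊎ ConsecIn L b a)
  ⊎ (∃[ f ] ∃[ l ] ((∃[ r ] L ≡ f ∷ r) × last L ≡ just l
                   × ((a ≡ l × b ≡ f) ⊎ (a ≡ f × b ≡ l))))

cycleEdgeIn-sym : ∀ {n} {L : List (Fin n)} {a b} → CycleEdgeIn L a b → CycleEdgeIn L b a
cycleEdgeIn-sym (inj₁ (inj₁ c)) = inj₁ (inj₂ c)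
cycleEdgeIn-sym (inj₁ (inj₂ c)) = inj₁ (inj₁ c)
cycleEdgeIn-sym (inj₂ (f , l , r , e , inj₁ (p , q))) = inj₂ (f , l , r , e , inj₂ (q , p))
cycleEdgeIn-sym (inj₂ (f , l , r , e , inj₂ (p , q))) = inj₂ (f , l , r , e , inj₁ (q , p))

cycleEdgeIn-pair : ∀ {n} {L : List (Fin n)} {s t a b} → CycleEdgeIn L s t → Pair s t a b → CycleEdgeIn L a b
cycleEdgeIn-pair c (inj₁ (refl , refl)) = c
cycleEdgeIn-pair c (inj₂ (refl , refl)) = cycleEdgeIn-sym c

cycleEdgeIn-∈ : ∀ {n} {L : List (Fin n)} {a b} → CycleEdgeIn L a b → a ∈ L × b ∈ L
cycleEdgeIn-∈ (inj₁ (inj₁ c)) = consecIn-∈ˡ c , consecIn-∈ʳ c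
cycleEdgeIn-∈ (inj₁ (inj₂ c)) = consecIn-∈ʳ c , consecIn-∈ˡ c
cycleEdgeIn-∈ {L = L} (inj₂ (f , l , (r , refl) , e , inj₁ (refl , refl))) = last-∈ L e , here refl
cycleEdgeIn-∈ {L = L} (inj₂ (f , l , (r , refl) , e , inj₂ (refl , refl))) = here refl , last-∈ L e

cycleEdgeIn-incident : ∀ {n} {L : List (Fin n)} {x} → x ∈ L → ∃[ y ] CycleEdgeIn L x y
cycleEdgeIn-incident {L = h ∷ t} {x} m with succ-or-last m
... | inj₁ (s , c) = s , inj₁ (inj₁ c)
... | inj₂ e       = h , inj₂ (h , x , (t , refl) , e , inj₁ (refl , refl))

consecIn? : ∀ {n} (L : List (Fin n)) a b → Dec (ConsecIn L a b)
consecIn? []           a b = no λ ()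
consecIn? (x ∷ [])     a b = no λ { (there _ _ _ _ ()) }
consecIn? (x ∷ y ∷ vs) a b with consecIn? (y ∷ vs) a b | a ≟ x | b ≟ y
... | yes c | _        | _        = yes (there x (y ∷ vs) a b c)
... | no _  | yes refl | yes refl = yes (here x y vs)
... | no ¬c | no a≢x   | _        = no λ { (here _ _ _) → a≢x refl ; (there _ _ _ _ c) → ¬c c }
... | no ¬c | yes _    | no b≢y   = no λ { (here _ _ _) → b≢y refl ; (there _ _ _ _ c) → ¬c c }

closingEdge? : ∀ {n} (L : List (Fin n)) a b →
  Dec (∃[ f ] ∃[ l ] ((∃[ r ] L ≡ f ∷ r) × last L ≡ just l × ((a ≡ l × b ≡ f) ⊎ (a ≡ f × b ≡ l))))
closingEdge? []      a b = no λ { (_ , _ , (_ , ()) , _) }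
closingEdge? (h ∷ t) a b with last-∷ h t
... | l , el = map′ (λ o → h , l , (t , refl) , el , o) from (((a ≟ l) ×-dec (b ≟ h)) ⊎-dec ((a ≟ h) ×-dec (b ≟ l)))
  where
  from : ∀ {a b} → ∃[ f ] ∃[ l′ ] ((∃[ r ] h ∷ t ≡ f ∷ r) × last (h ∷ t) ≡ just l′ × ((a ≡ l′ × b ≡ f) ⊎ (a ≡ f × b ≡ l′))) →
         (a ≡ l × b ≡ h) ⊎ (a ≡ h × b ≡ l)
  from (_ , _ , (_ , refl) , el′ , o) with just-injective (trans (sym el) el′)
  ... | refl = o

cycleEdgeIn? : ∀ {n} (L : List (Fin n)) a b → Dec (CycleEdgeIn L a b)
cycleEdgeIn? L a b = (consecIn? L a b ⊎-dec consecIn? L b a) ⊎-dec closingEdge? L a b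

isPath-consecIn : ∀ {n} {G : Graph n} {L} → IsPath G L → ∀ {a b} → ConsecIn L a b → Edge G a b
isPath-consecIn (cons x y vs e p) (here _ _ _)       = e
isPath-consecIn (cons x y vs e p) (there _ _ _ _ c) = isPath-consecIn p c

consecIn⇒isPath : ∀ {n} {G : Graph n} (L : List (Fin n)) → (∀ {a b} → ConsecIn L a b → Edge G a b) → IsPath G L
consecIn⇒isPath []           f = nil
consecIn⇒isPath (x ∷ [])     f = one x
consecIn⇒isPath (x ∷ y ∷ vs) f = cons x y vs (f (here x y vs)) (consecIn⇒isPath (y ∷ vs) (f ∘ there x (y ∷ vs) _ _))

consecIn-star-head : ∀ {n} {R : Fin n → Fin n → Set} {h t x} →
                     (∀ {a b} → ConsecIn (h ∷ t) a b → R a b) → x ∈ h ∷ t → Star R h x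
consecIn-star-head f (here refl) = ε
consecIn-star-head {h = h} {t = y ∷ ys} f (there m) = f (here h y ys) ◅ consecIn-star-head (f ∘ there h (y ∷ ys) _ _) m

consecIn-star : ∀ {n} {R : Fin n → Fin n → Set} {L x y} → (∀ {a b} → R a b → R b a) →
                (∀ {a b} → ConsecIn L a b → R a b) → x ∈ L → y ∈ L → Star R x y
consecIn-star {L = h ∷ t} R-sym f x∈ y∈ = Closure.reverse R-sym (consecIn-star-head f x∈) ◅◅ consecIn-star-head f y∈

connected-sym : ∀ {n} (G : Graph n) {a b} → Connected G a b → Connected G b a
connected-sym G = Closure.reverse (edge-sym G)

connected-⊆ : ∀ {n} {G G′ : Graph n} → (∀ {x y} → Edge G x y → Edge G′ x y) → ∀ {a b} → Connected G a b → Connected G′ a b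
connected-⊆ G⊆G′ = Closure.map G⊆G′

cycleEdge⇒edge : ∀ {n} {G : Graph n} (C : Cycle G) {a b} → CycleEdge C a b → Edge G a b
cycleEdge⇒edge C (inj₁ (inj₁ c)) = isPath-consecIn (path C) c
cycleEdge⇒edge {G = G} C (inj₁ (inj₂ c)) = edge-sym G (isPath-consecIn (path C) c)
cycleEdge⇒edge C (inj₂ (f , l , (r , e₁) , e₂ , inj₁ (refl , refl))) = closing C f r l e₁ e₂
cycleEdge⇒edge {G = G} C (inj₂ (f , l , (r , e₁) , e₂ , inj₂ (refl , refl))) = edge-sym G (closing C f r l e₁ e₂)

cycle-connected : ∀ {n} {G : Graph n} (C : Cycle G) {x y} → x ∈ verts C → y ∈ verts C → Connected G x y
cycle-connected {G = G} C = consecIn-star (edge-sym G) (isPath-consecIn (path C))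

sameCycle-∈ : ∀ {n} {G : Graph n} {C D : Cycle G} → SameCycle C D → ∀ {x} → x ∈ verts C → x ∈ verts D
sameCycle-∈ {C = C} C≡D {x} m with cycleEdgeIn-incident {L = verts C} m
... | y , ce = proj₁ (cycleEdgeIn-∈ (proj₁ (C≡D x y) ce))

cycle-map : ∀ {n} {G G′ : Graph n} (C : Cycle G) → (∀ {a b} → CycleEdge C a b → Edge G′ a b) → Cycle G′
verts    (cycle-map C f) = verts C
long     (cycle-map C f) = long C
distinct (cycle-map C f) = distinct C
path     (cycle-map C f) = consecIn⇒isPath (verts C) (f ∘ inj₁ ∘ inj₁)
closing  (cycle-map C f) fi r l e₁ e₂ = f (inj₂ (fi , l , (r , e₁) , e₂ , inj₁ (refl , refl)))

cycle-⊆ : ∀ {n} {G G′ : Graph n} → (∀ {x y} → Edge G x y → Edge G′ x y) → Cycle G → Cycle G′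
cycle-⊆ G⊆G′ C = cycle-map C (G⊆G′ ∘ cycleEdge⇒edge C)

pseudoforest-⊆ : ∀ {n} {G G′ : Graph n} → (∀ {x y} → Edge G x y → Edge G′ x y) → Pseudoforest G′ → Pseudoforest G
pseudoforest-⊆ {G = G} {G′} G⊆G′ pf C D x y x∈C y∈D x~y =
  pf (cycle-⊆ G⊆G′ C) (cycle-⊆ G⊆G′ D) x y x∈C y∈D (connected-⊆ {G = G} {G′} G⊆G′ x~y)

pseudoforest-≅ : ∀ {n} {G G′ : Graph n} → G ≅ G′ → Pseudoforest G → Pseudoforest G′
pseudoforest-≅ G≅G′ = pseudoforest-⊆ (≅-edge (≅-sym G≅G′))

too-short : ∀ {A : Set} {r : List A} {l} → r ≡ l ∷ [] → ¬ 3 ≤ suc (length r)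
too-short refl (s≤s (s≤s ()))

cycle-two-neighbours : ∀ {n} {G : Graph n} (C : Cycle G) {x} → x ∈ verts C →
                       ∃[ p ] ∃[ s ] (p ≢ s × CycleEdge C x p × CycleEdge C x s)
cycle-two-neighbours C {x} m with verts C | long C | distinct C
... | h ∷ t | lg | u with succ-or-last m | pred-or-head m | last-∷ h t
... | inj₁ (s , cs) | inj₁ (p , cp) | _ = p , s , (λ { refl → consecIn-asym u cp cs }) , inj₁ (inj₂ cp) , inj₁ (inj₁ cs)
... | inj₁ (s , cs) | inj₂ refl | l , el = l , s , l≢s , inj₂ (h , l , (t , refl) , el , inj₂ (refl , refl)) , inj₁ (inj₁ cs)
  where
  l≢s : l ≢ s
  l≢s refl = too-short (consecIn-head-last u el cs) lg
... | inj₂ el | inj₁ (p , cp) | _ = p , h , p≢h , inj₁ (inj₂ cp) , inj₂ (h , x , (t , refl) , el , inj₁ (refl , refl))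
  where
  p≢h : p ≢ h
  p≢h refl = too-short (consecIn-head-last u el cp) lg
... | inj₂ el | inj₂ refl | _ = ⊥-elim (short t u el lg)
  where
  short : ∀ t → Unique (x ∷ t) → last (x ∷ t) ≡ just x → 3 ≤ suc (length t) → ⊥
  short []       u e (s≤s ())
  short (y ∷ ys) u e lg = Unique[x∷xs]⇒x∉xs u (last-∈ (y ∷ ys) e)

module _ {n} {G : Graph n} (deg≤2 : ∀ z → deg G z ≤ 2) (C : Cycle G) where

  deg≤2⇒cycleEdge : ∀ {x t} → x ∈ verts C → Edge G x t → CycleEdge C x t
  deg≤2⇒cycleEdge {x} x∈C e with cycle-two-neighbours C x∈C
  ... | p , s , p≢s , cp , cs with deg≤2⇒third-edge G (deg≤2 x) (cycleEdge⇒edge C cp) (cycleEdge⇒edge C cs) p≢s e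
  ... | inj₁ refl = cp
  ... | inj₂ refl = cs

  deg≤2⇒component-on-cycle : ∀ {x y} → x ∈ verts C → Connected G x y → y ∈ verts C
  deg≤2⇒component-on-cycle x∈C ε       = x∈C
  deg≤2⇒component-on-cycle x∈C (e ◅ p) = deg≤2⇒component-on-cycle (proj₂ (cycleEdgeIn-∈ (deg≤2⇒cycleEdge x∈C e))) p

deg≤2⇒pseudoforest : ∀ {n} {G : Graph n} → (∀ z → deg G z ≤ 2) → Pseudoforest G
deg≤2⇒pseudoforest {G = G} deg≤2 C D x y x∈C y∈D x~y a b = included C D x~y x∈C y∈D , included D C (connected-sym G x~y) y∈D x∈C
  where
  included : ∀ (C D : Cycle G) {x y} → Connected G x y → x ∈ verts C → y ∈ verts D → CycleEdge C a b → CycleEdge D a b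
  included C D x~y x∈C y∈D ce = deg≤2⇒cycleEdge deg≤2 D a∈D (cycleEdge⇒edge C ce)
    where
    a∈D : a ∈ verts D
    a∈D = deg≤2⇒component-on-cycle deg≤2 D y∈D (connected-sym G x~y ◅◅ cycle-connected C x∈C (proj₁ (cycleEdgeIn-∈ ce)))

record SimplePath {n} (G : Graph n) (x y : Fin n) : Set where
  constructor simplePath
  field
    inner  : List (Fin n)
    unique : Unique (x ∷ inner)
    isPath : IsPath G (x ∷ inner)
    ends   : last (x ∷ inner) ≡ just y

isPath-tail : ∀ {n} {G : Graph n} {x L} → IsPath G (x ∷ L) → IsPath G L
isPath-tail (one x)           = nil
isPath-tail (cons x y vs e p) = p

isPath-++ʳ : ∀ {n} {G : Graph n} (pre : List (Fin n)) {ys} → IsPath G (pre ++ ys) → IsPath G ys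
isPath-++ʳ []        p = p
isPath-++ʳ (x ∷ pre) p = isPath-++ʳ pre (isPath-tail p)

∈? : ∀ {n} (x : Fin n) (L : List (Fin n)) → Dec (x ∈ L)
∈? x = Any.any? (x ≟_)

connected⇒simplePath : ∀ {n} (G : Graph n) {x y} → Connected G x y → SimplePath G x y
connected⇒simplePath G {x = x} ε = simplePath [] ([] ∷ []) (one x) refl
connected⇒simplePath G {x} (_◅_ {j = x′} e p) with connected⇒simplePath G p
... | simplePath ps u q l with ∈? x (x′ ∷ ps)
... | no x∉ = simplePath (x′ ∷ ps) (unique-∷ x∉ u) (cons x x′ ps e q) l
... | yes x∈ with ∈-∃++ x∈
... | pre , post , eq = simplePath post (unique-++ʳ pre (subst Unique eq u)) (isPath-++ʳ pre (subst (IsPath G) eq q))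
                          (trans (sym (last-++ pre x post)) (trans (cong last (sym eq)) l))

edge-on-cycle : ∀ {n} (G : Graph n) {a b} → Edge G a b → Connected (removeEdge G a b) b a → Σ (Cycle G) (λ C → CycleEdge C a b)
edge-on-cycle G {a} {b} eab b~a with connected⇒simplePath (removeEdge G a b) b~a
... | simplePath [] u p refl = ⊥-elim (edge-irrefl G eab)
... | simplePath (q ∷ []) u (cons _ _ _ eba _) refl = ⊥-elim (proj₂ (removeEdge⁻ G a b eba) (pair-sym pair-refl))
... | simplePath (q ∷ r ∷ ps) u p l = C , inj₂ (b , a , (q ∷ r ∷ ps , refl) , l , inj₁ (refl , refl))
  where
  C : Cycle G
  verts    C = b ∷ q ∷ r ∷ ps
  long     C = s≤s (s≤s (s≤s z≤n))
  distinct C = u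
  path     C = consecIn⇒isPath _ (removeEdge-⊆ G a b ∘ isPath-consecIn p)
  closing  C f rs lst refl l′ with trans (sym l) l′
  ... | refl = eab

OtherCycleEdge : ∀ {n} → List (Fin n) → Fin n → Fin n → Fin n → Fin n → Set
OtherCycleEdge L a b p q = CycleEdgeIn L p q × ¬ Pair p q a b

otherCycleEdge-sym : ∀ {n} {L : List (Fin n)} {a b p q} → OtherCycleEdge L a b p q → OtherCycleEdge L a b q p
otherCycleEdge-sym (c , ¬p) = cycleEdgeIn-sym c , ¬p ∘ pair-sym

otherCycleEdge-flip : ∀ {n} {L : List (Fin n)} {a b p q} → OtherCycleEdge L a b p q → OtherCycleEdge L b a p q
otherCycleEdge-flip (c , ¬p) = c , ¬p ∘ pair-flip

++-head : ∀ {A : Set} (pre : List A) x rest → ∃[ h ] ∃[ t ] ((pre ++ x ∷ rest ≡ h ∷ t) × h ∈ pre ++ x ∷ [])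
++-head []      x rest = x , rest , refl , here refl
++-head (p ∷ _) x rest = p , _ , refl , here refl

module _ {n} {L : List (Fin n)} (u : Unique L) (lg : 3 ≤ length L) where

  -- Going around the cycle the long way, from y to the last vertex, back to the head and on to x.
  consecutive-other-way : ∀ {x y} → ConsecIn L x y → Star (OtherCycleEdge L x y) y x
  consecutive-other-way {x} {y} c with consecIn-split c
  ... | pre , post , refl with last-∷ y post
  ... | l , el with ++-head pre x (y ∷ post)
  ... | h , t , eqL , h∈M = to-last ◅◅ (wrap ◅ from-head)
    where
    x∉ : x ∉ y ∷ post
    x∉ = Unique[x∷xs]⇒x∉xs (unique-++ʳ pre u)
    elL : last (pre ++ x ∷ y ∷ post) ≡ just l
    elL = trans (last-++ pre x (y ∷ post)) el
    to-last : Star (OtherCycleEdge L x y) y l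
    to-last = consecIn-star-head step (last-∈ (y ∷ post) el)
      where
      step : ∀ {p q} → ConsecIn (y ∷ post) p q → OtherCycleEdge L x y p q
      step cc = inj₁ (inj₁ (consecIn-++⁺ʳ pre (there x _ _ _ cc))) , λ
        { (inj₁ (refl , _)) → x∉ (consecIn-∈ˡ cc) ; (inj₂ (_ , refl)) → x∉ (consecIn-∈ʳ cc) }
    M : List (Fin n)
    M = pre ++ x ∷ []
    eqM : M ++ y ∷ post ≡ pre ++ x ∷ y ∷ post
    eqM = ++-assoc pre (x ∷ []) (y ∷ post)
    -- The closing edge from the last vertex back to the head; it could only be xy on a cycle of length 2.
    wrap : OtherCycleEdge L x y l h
    wrap = inj₂ (h , l , (t , eqL) , elL , inj₁ (refl , refl)) , not-xy
      where
      not-xy : ¬ Pair l h x y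
      not-xy (inj₁ (refl , _))    = consecIn-last u elL c
      not-xy (inj₂ (refl , refl)) =
        too-short (consecIn-head-last (subst Unique eqL u) (trans (cong last (sym eqL)) elL) (subst (λ L′ → ConsecIn L′ x l) eqL c))
                  (subst (λ L′ → 3 ≤ length L′) eqL lg)
    from-head : Star (OtherCycleEdge L x y) h x
    from-head = consecIn-star otherCycleEdge-sym step h∈M (∈-++⁺ʳ pre (here refl))
      where
      uM : Unique (M ++ y ∷ post)
      uM = subst Unique (sym eqM) u
      step : ∀ {p q} → ConsecIn M p q → OtherCycleEdge L x y p q
      step cc = inj₁ (inj₁ (subst (λ L′ → ConsecIn L′ _ _) eqM (consecIn-++⁺ˡ (y ∷ post) cc))) , λ
        { (inj₁ (_ , refl)) → unique-++-disjoint M uM (consecIn-∈ʳ cc) (here refl)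
        ; (inj₂ (refl , _)) → unique-++-disjoint M uM (consecIn-∈ˡ cc) (here refl) }

  closing-other-way : ∀ {h t l} → L ≡ h ∷ t → last L ≡ just l → Star (OtherCycleEdge L l h) h l
  closing-other-way {h} {t} {l} refl el = consecIn-star-head step (last-∈ L el)
    where
    step : ∀ {p q} → ConsecIn L p q → OtherCycleEdge L l h p q
    step c = inj₁ (inj₁ c) , λ
      { (inj₁ (refl , refl)) → consecIn-last u el c
      ; (inj₂ (refl , refl)) → too-short (consecIn-head-last u el c) lg }

  cycleEdge-other-way : ∀ {a b} → CycleEdgeIn L a b → Star (OtherCycleEdge L a b) a b
  cycleEdge-other-way (inj₁ (inj₁ c)) = Closure.reverse otherCycleEdge-sym (consecutive-other-way c)
  cycleEdge-other-way (inj₁ (inj₂ c)) = Closure.map otherCycleEdge-flip (consecutive-other-way c)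
  cycleEdge-other-way (inj₂ (f , l , (r , eq) , el , inj₁ (refl , refl))) =
    Closure.reverse otherCycleEdge-sym (closing-other-way eq el)
  cycleEdge-other-way (inj₂ (f , l , (r , eq) , el , inj₂ (refl , refl))) =
    Closure.map otherCycleEdge-flip (closing-other-way eq el)

cycle-other-way : ∀ {n} {G : Graph n} (C : Cycle G) {a b} → CycleEdge C a b → Star (OtherCycleEdge (verts C) a b) a b
cycle-other-way C = cycleEdge-other-way (distinct C) (long C)

-- Adding an edge to a pseudoforest

AcyclicComponent : ∀ {n} → Graph n → Fin n → Set
AcyclicComponent {n} K x = ∀ (D : Cycle K) (p : Fin n) → p ∈ verts D → ¬ Connected K p x

module AddEdge {n} (K : Graph n) (u x : Fin n) (u≢x : u ≢ x) where

  K⁺ : Graph n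
  K⁺ = addEdge K u x u≢x

  old-edge : ∀ {s t} → Edge K⁺ s t → ¬ Pair s t u x → Edge K s t
  old-edge e ¬p with addEdge⁻ K u x u≢x e
  ... | inj₁ e′ = e′
  ... | inj₂ p  = ⊥-elim (¬p p)

  cycle-avoiding : (E : Cycle K⁺) → ¬ CycleEdge E u x → Cycle K
  cycle-avoiding E ¬ux = cycle-map E λ ce → old-edge (cycleEdge⇒edge E ce) (¬ux ∘ cycleEdgeIn-pair ce)

  cycle-through⇒connected : (E : Cycle K⁺) → CycleEdge E u x → Connected K u x
  cycle-through⇒connected E ux = Closure.map (λ (ce , ¬p) → old-edge (cycleEdge⇒edge E ce) ¬p) (cycle-other-way E ux)

  reroute : Connected K u x → ∀ {s t} → Connected K⁺ s t → Connected K s t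
  reroute u~x = Closure._⋆ step
    where
    step : ∀ {s t} → Edge K⁺ s t → Connected K s t
    step {s} {t} e with pair? s t u x
    ... | yes (inj₁ (refl , refl)) = u~x
    ... | yes (inj₂ (refl , refl)) = connected-sym K u~x
    -- Here `with` has rewritten the type of e to Edge K s t, as pair? s t u x occurs in it.
    ... | no _ = e ◅ ε

  Touches : Fin n → Set
  Touches s = Connected K s u ⊎ Connected K s x

  split : ∀ {s t} → Connected K⁺ s t → Connected K s t ⊎ (Touches s × (Connected K u t ⊎ Connected K x t))
  split ε = inj₁ ε
  split (_◅_ {s} {s′} e rest) with pair? s s′ u x | split rest
  ... | yes (inj₁ (refl , refl)) | inj₁ c = inj₂ (inj₁ ε , inj₂ c)
  ... | yes (inj₂ (refl , refl)) | inj₁ c = inj₂ (inj₂ ε , inj₁ c)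
  ... | yes (inj₁ (refl , refl)) | inj₂ (_ , r) = inj₂ (inj₁ ε , r)
  ... | yes (inj₂ (refl , refl)) | inj₂ (_ , r) = inj₂ (inj₂ ε , r)
  ... | no _ | inj₁ c = inj₁ (e ◅ c)
  ... | no _ | inj₂ (inj₁ l , r) = inj₂ (inj₁ (e ◅ l) , r)
  ... | no _ | inj₂ (inj₂ l , r) = inj₂ (inj₂ (e ◅ l) , r)

  module _ (pf : Pseudoforest K) (acyclic : AcyclicComponent K x)
           (C D : Cycle K⁺) {p q} (p∈C : p ∈ verts C) (q∈D : q ∈ verts D) (p~q : Connected K⁺ p q) {a b}
           (ab∈C : CycleEdge C a b) (ab∉D : ¬ CycleEdge D a b) where

    -- Both cycles are cycles of K; a walk between them in K⁺ either stays in K or passes through x, whose component is acyclic.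
    both-old : (¬ux∈C : ¬ CycleEdge C u x) (¬ux∈D : ¬ CycleEdge D u x) → ⊥
    both-old ¬ux∈C ¬ux∈D = by-split (split p~q)
      where
      C′ D′ : Cycle K
      C′ = cycle-avoiding C ¬ux∈C
      D′ = cycle-avoiding D ¬ux∈D
      same-component : Connected K p q → ⊥
      same-component c = ab∉D (proj₁ (pf C′ D′ p q p∈C q∈D c a b) ab∈C)
      by-split : Connected K p q ⊎ (Touches p × (Connected K u q ⊎ Connected K x q)) → ⊥
      by-split (inj₁ p~q′)                  = same-component p~q′
      by-split (inj₂ (inj₂ p~x , _))         = acyclic C′ p p∈C p~x
      by-split (inj₂ (inj₁ _ , inj₂ x~q))    = acyclic D′ q q∈D (connected-sym K x~q)
      by-split (inj₂ (inj₁ p~u , inj₁ u~q)) = same-component (p~u ◅◅ u~q)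

    new-old : CycleEdge C u x → (¬ux∈D : ¬ CycleEdge D u x) → ⊥
    new-old ux∈C ¬ux∈D = acyclic (cycle-avoiding D ¬ux∈D) q q∈D
      (reroute (cycle-through⇒connected C ux∈C) (connected-sym K⁺ p~q ◅◅ cycle-connected C p∈C (proj₂ (cycleEdgeIn-∈ ux∈C))))

    old-new : (¬ux∈C : ¬ CycleEdge C u x) → CycleEdge D u x → ⊥
    old-new ¬ux∈C ux∈D = acyclic (cycle-avoiding C ¬ux∈C) p p∈C
      (reroute (cycle-through⇒connected D ux∈D) (p~q ◅◅ cycle-connected D q∈D (proj₂ (cycleEdgeIn-∈ ux∈D))))

    -- Both cycles use ux; then ab is an old edge, and C with ux replaced by the rest of D still closes a cycle through ab in K.
    new-new : CycleEdge C u x → CycleEdge D u x → ⊥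
    new-new ux∈C ux∈D with edge-on-cycle K eab (connected-sym (removeEdge K a b) a~b)
      where
      ¬ab : ¬ Pair a b u x
      ¬ab = ab∉D ∘ cycleEdgeIn-pair ux∈D ∘ pair-swap
      eab : Edge K a b
      eab = old-edge (cycleEdge⇒edge C ab∈C) ¬ab
      u~x : Connected (removeEdge K a b) u x
      u~x = Closure.map (λ (ce , ¬p) → removeEdge⁺ K a b (old-edge (cycleEdge⇒edge D ce) ¬p) (ab∉D ∘ cycleEdgeIn-pair ce))
                        (cycle-other-way D ux∈D)
      step : ∀ {s t} → OtherCycleEdge (verts C) a b s t → Connected (removeEdge K a b) s t
      step {s} {t} (ce , ¬p) with pair? s t u x
      ... | yes (inj₁ (refl , refl)) = u~x
      ... | yes (inj₂ (refl , refl)) = connected-sym (removeEdge K a b) u~x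
      ... | no ¬q = removeEdge⁺ K a b (old-edge (cycleEdge⇒edge C ce) ¬q) ¬p ◅ ε
      a~b : Connected (removeEdge K a b) a b
      a~b = (step Closure.⋆) (cycle-other-way C ab∈C)
    ... | E , ab∈E = acyclic E a (proj₁ (cycleEdgeIn-∈ ab∈E))
      (reroute (cycle-through⇒connected C ux∈C) (cycle-connected C (proj₁ (cycleEdgeIn-∈ ab∈C)) (proj₂ (cycleEdgeIn-∈ ux∈C))))

    impossible : ⊥
    impossible with cycleEdgeIn? (verts C) u x | cycleEdgeIn? (verts D) u x
    ... | no ¬ux∈C | no ¬ux∈D = both-old ¬ux∈C ¬ux∈D
    ... | yes ux∈C | no ¬ux∈D = new-old ux∈C ¬ux∈D
    ... | no ¬ux∈C | yes ux∈D = old-new ¬ux∈C ux∈D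
    ... | yes ux∈C | yes ux∈D = new-new ux∈C ux∈D

pseudoforest-addEdge : ∀ {n} {K : Graph n} {u x} (u≢x : u ≢ x) → Pseudoforest K → AcyclicComponent K x → Pseudoforest (addEdge K u x u≢x)
pseudoforest-addEdge {K = K} {u} {x} u≢x pf acyclic C D p q p∈C q∈D p~q a b =
  included C D p∈C q∈D p~q , included D C q∈D p∈C (connected-sym (addEdge K u x u≢x) p~q)
  where
  open AddEdge K u x u≢x
  included : ∀ (C D : Cycle K⁺) {p q} → p ∈ verts C → q ∈ verts D → Connected K⁺ p q → CycleEdge C a b → CycleEdge D a b
  included C D p∈C q∈D p~q ab∈C with cycleEdgeIn? (verts D) a b
  ... | yes ab∈D = ab∈D
  ... | no ab∉D  = ⊥-elim (impossible pf acyclic C D p∈C q∈D p~q ab∈C ab∉D)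

isolated⇒acyclicComponent : ∀ {n} (K : Graph n) {v} → deg K v ≡ 0 → AcyclicComponent K v
isolated⇒acyclicComponent K {v} d0 D p p∈D p~v with isolated p~v
  where
  isolated : ∀ {p} → Connected K p v → p ≡ v
  isolated ε = refl
  isolated (e ◅ c) with isolated c
  ... | refl = ⊥-elim (deg-zero K d0 (edge-sym K e))
... | refl with cycleEdgeIn-incident {L = verts D} p∈D
... | _ , ce = deg-zero K d0 (cycleEdge⇒edge D ce)

addEdge-comm : ∀ {n} (K : Graph n) {a b} (a≢b : a ≢ b) (b≢a : b ≢ a) → addEdge K a b a≢b ≅ addEdge K b a b≢a
addEdge-comm K a≢b b≢a = ≅-intro (move a≢b b≢a) (move b≢a a≢b)
  where
  move : ∀ {c d} (c≢d : c ≢ d) (d≢c : d ≢ c) {x y} → Edge (addEdge K c d c≢d) x y → Edge (addEdge K d c d≢c) x y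
  move c≢d d≢c e = [ addEdge⁺ˡ K _ _ d≢c , addEdge⁺ʳ K _ _ d≢c ∘ pair-flip ]′ (addEdge⁻ K _ _ c≢d e)

pseudoforest-addPendant : ∀ {n} {K : Graph n} {v w} (v≢w : v ≢ w) → Pseudoforest K → deg K v ≡ 0 → Pseudoforest (addEdge K v w v≢w)
pseudoforest-addPendant {K = K} {v} {w} v≢w pf d0 =
  pseudoforest-≅ (addEdge-comm K (≢-sym v≢w) v≢w) (pseudoforest-addEdge (≢-sym v≢w) pf (isolated⇒acyclicComponent K d0))

-- Deciding whether a graph is a pseudoforest

unique-length-≤ : ∀ {A : Set} (xs ys : List A) → Unique xs → (∀ {x} → x ∈ xs → x ∈ ys) → length xs ≤ length ys
unique-length-≤ []       ys u xs⊆ys = z≤n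
unique-length-≤ (x ∷ xs) ys u xs⊆ys with ∈-∃++ (xs⊆ys (here refl))
... | pre , post , refl = subst (suc (length xs) ≤_) (sym length-removed) (s≤s (unique-length-≤ xs (pre ++ post) (unique-tail u) shrink))
  where
  length-removed : length (pre ++ x ∷ post) ≡ suc (length (pre ++ post))
  length-removed = trans (length-++ pre) (trans (+-suc (length pre) (length post)) (cong suc (sym (length-++ pre))))
  drop : ∀ pre {y} → y ∈ pre ++ x ∷ post → y ≢ x → y ∈ pre ++ post
  drop []        (here refl) y≢x = ⊥-elim (y≢x refl)
  drop []        (there m)   y≢x = m
  drop (z ∷ pre) (here refl) y≢x = here refl
  drop (z ∷ pre) (there m)   y≢x = there (drop pre m y≢x)
  shrink : ∀ {y} → y ∈ xs → y ∈ pre ++ post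
  shrink y∈xs = drop pre (xs⊆ys (there y∈xs)) λ { refl → Unique[x∷xs]⇒x∉xs u y∈xs }

unique-length-≤-n : ∀ {n} (L : List (Fin n)) → Unique L → length L ≤ n
unique-length-≤-n {n} L u = subst (length L ≤_) (length-tabulate {n = n} (λ i → i)) (unique-length-≤ L (allFin n) u (λ {x} _ → ∈-allFin x))

∀-bounded? : ∀ {n} k (P : List (Fin n) → Set) → (∀ L → Dec (P L)) → Dec (∀ L → length L ≤ k → P L)
∀-bounded? zero P P? with P? []
... | yes p = yes λ { [] _ → p ; (x ∷ L) () }
... | no ¬p = no λ f → ¬p (f [] z≤n)
∀-bounded? (suc k) P P? with P? [] | all? (λ x → ∀-bounded? k (P ∘ (x ∷_)) (P? ∘ (x ∷_)))
... | yes p | yes f = yes λ { [] _ → p ; (x ∷ L) (s≤s le) → f x L le }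
... | no ¬p | _     = no λ f → ¬p (f [] z≤n)
... | _     | no ¬f = no λ f → ¬f λ x L le → f (x ∷ L) (s≤s le)

isPath? : ∀ {n} (G : Graph n) (L : List (Fin n)) → Dec (IsPath G L)
isPath? G []           = yes nil
isPath? G (x ∷ [])     = yes (one x)
isPath? G (x ∷ y ∷ vs) = map′ (λ (e , p) → cons x y vs e p) (λ { (cons _ _ _ e p) → e , p }) (T? (adj G x y) ×-dec isPath? G (y ∷ vs))

Closing : ∀ {n} → Graph n → List (Fin n) → Set
Closing G L = ∀ first rest lst → L ≡ first ∷ rest → last L ≡ just lst → Edge G lst first

closing? : ∀ {n} (G : Graph n) (L : List (Fin n)) → Dec (Closing G L)
closing? G []      = yes λ _ _ _ ()
closing? G (h ∷ t) with last-∷ h t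
... | l , el = map′ to (λ cl → cl h t l refl el) (T? (adj G l h))
  where
  to : Edge G l h → Closing G (h ∷ t)
  to e _ _ l′ refl el′ with just-injective (trans (sym el) el′)
  ... | refl = e

IsCycle : ∀ {n} → Graph n → List (Fin n) → Set
IsCycle G L = 3 ≤ length L × Unique L × IsPath G L × Closing G L

isCycle? : ∀ {n} (G : Graph n) L → Dec (IsCycle G L)
isCycle? G L = (3 ≤? length L) ×-dec (UniqueDec.unique? _≟_ L ×-dec (isPath? G L ×-dec closing? G L))

toCycle : ∀ {n} {G : Graph n} (L : List (Fin n)) → IsCycle G L → Cycle G
toCycle L (lg , u , p , cl) = record { verts = L ; long = lg ; distinct = u ; path = p ; closing = cl }

cycle-isCycle : ∀ {n} {G : Graph n} (C : Cycle G) → IsCycle G (verts C)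
cycle-isCycle C = long C , distinct C , path C , closing C

SameCycleIn : ∀ {n} → List (Fin n) → List (Fin n) → Set
SameCycleIn {n} L₁ L₂ = ∀ (a b : Fin n) → (CycleEdgeIn L₁ a b → CycleEdgeIn L₂ a b) × (CycleEdgeIn L₂ a b → CycleEdgeIn L₁ a b)

sameCycleIn? : ∀ {n} (L₁ L₂ : List (Fin n)) → Dec (SameCycleIn L₁ L₂)
sameCycleIn? L₁ L₂ = all? λ a → all? λ b → (cycleEdgeIn? L₁ a b →-dec cycleEdgeIn? L₂ a b) ×-dec (cycleEdgeIn? L₂ a b →-dec cycleEdgeIn? L₁ a b)

lastOf : ∀ {n} → Fin n → List (Fin n) → Fin n
lastOf p ps = proj₁ (last-∷ p ps)

-- Pseudoforest G with all quantifiers bounded: cycles and connecting paths are repetition-free, so have at most n vertices.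
BoundedPseudoforest : ∀ {n} → Graph n → Set
BoundedPseudoforest {n} G = ∀ L₁ → length L₁ ≤ n → ∀ L₂ → length L₂ ≤ n → IsCycle G L₁ → IsCycle G L₂ →
  ∀ (p : Fin n) ps → length ps ≤ n → IsPath G (p ∷ ps) → p ∈ L₁ → lastOf p ps ∈ L₂ → SameCycleIn L₁ L₂

boundedPseudoforest? : ∀ {n} (G : Graph n) → Dec (BoundedPseudoforest G)
boundedPseudoforest? {n} G =
  ∀-bounded? n _ λ L₁ → ∀-bounded? n _ λ L₂ → isCycle? G L₁ →-dec (isCycle? G L₂ →-dec
  all? λ p → ∀-bounded? n _ λ ps → isPath? G (p ∷ ps) →-dec (∈? p L₁ →-dec (∈? (lastOf p ps) L₂ →-dec sameCycleIn? L₁ L₂)))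

boundedPseudoforest⇒pseudoforest : ∀ {n} (G : Graph n) → BoundedPseudoforest G → Pseudoforest G
boundedPseudoforest⇒pseudoforest {n} G bpf C D x y x∈C y∈D x~y with connected⇒simplePath G x~y
... | simplePath ps u p l =
  bpf (verts C) (unique-length-≤-n _ (distinct C)) (verts D) (unique-length-≤-n _ (distinct D)) (cycle-isCycle C) (cycle-isCycle D)
      x ps (≤-trans (n≤1+n (length ps)) (unique-length-≤-n (x ∷ ps) u)) p x∈C last∈D
  where
  last∈D : lastOf x ps ∈ verts D
  last∈D with last-∷ x ps
  ... | l′ , el′ with just-injective (trans (sym el′) l)
  ... | refl = y∈D

pseudoforest⇒boundedPseudoforest : ∀ {n} (G : Graph n) → Pseudoforest G → BoundedPseudoforest G
pseudoforest⇒boundedPseudoforest G pf L₁ _ L₂ _ c₁ c₂ p ps _ path p∈L₁ last∈L₂ =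
  pf (toCycle L₁ c₁) (toCycle L₂ c₂) p (lastOf p ps) p∈L₁ last∈L₂
     (consecIn-star-head (isPath-consecIn path) (last-∈ (p ∷ ps) (proj₂ (last-∷ p ps))))

pseudoforest? : ∀ {n} (G : Graph n) → Dec (Pseudoforest G)
pseudoforest? G = map′ (boundedPseudoforest⇒pseudoforest G) (pseudoforest⇒boundedPseudoforest G) (boundedPseudoforest? G)

-- Leafless pseudoforests have maximum degree 2

Leafless : ∀ {n} → Graph n → Set
Leafless {n} G = ∀ (z : Fin n) → deg G z ≢ 1

leafless-deg≥2 : ∀ {n} {G : Graph n} → Leafless G → ∀ {v} → 1 ≤ deg G v → 2 ≤ deg G v
leafless-deg≥2 {G = G} leafless {v} d≥1 with deg G v | leafless v
... | suc zero    | d≢1 = ⊥-elim (d≢1 refl)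
... | suc (suc _) | _   = s≤s (s≤s z≤n)

leafless-second-edge : ∀ {n} (G : Graph n) → Leafless G → ∀ {v p} → Edge G v p → ∃[ x ] (Edge G v x × x ≢ p)
leafless-second-edge G leafless e = deg≥2⇒other-edge G (leafless-deg≥2 {G = G} leafless (edge⇒deg-pos G e)) e

record Chord {n} (G : Graph n) (P : List (Fin n)) : Set where
  field
    head next   : Fin n
    rest        : List (Fin n)
    shape       : P ≡ head ∷ next ∷ rest
    unique      : Unique P
    isPath      : IsPath G P
    target      : Fin n
    edge        : Edge G head target
    target≢next : target ≢ next
    target∈     : target ∈ P

-- Keep prepending a new neighbour of the first vertex; after at most n steps it must be a repeat.
grow-chord : ∀ {n} {G : Graph n} → Leafless G → ∀ k (q p : Fin n) rest → n < length (q ∷ p ∷ rest) + k →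
             Unique (q ∷ p ∷ rest) → IsPath G (q ∷ p ∷ rest) → ∃[ Q ] Chord G (Q ++ q ∷ p ∷ rest)
grow-chord {n} {G} leafless k q p rest lt u path@(cons _ _ _ eqp _) with leafless-second-edge G leafless eqp
... | r , eqr , r≢p with ∈? r (q ∷ p ∷ rest)
... | yes r∈ = [] , record { head = q ; next = p ; rest = rest ; shape = refl ; unique = u ; isPath = path
                           ; target = r ; edge = eqr ; target≢next = r≢p ; target∈ = r∈ }
... | no r∉ with k
... | zero = ⊥-elim (<-irrefl refl (≤-<-trans (unique-length-≤-n _ u) (subst (n <_) (+-identityʳ _) lt)))
... | suc k′ with grow-chord leafless k′ r q (p ∷ rest) (subst (n <_) (+-suc _ k′) lt) (unique-∷ r∉ u) (cons r q (p ∷ rest) (edge-sym G eqr) path)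
... | Q , chord = Q ++ r ∷ [] , subst (Chord G) (sym (++-assoc Q (r ∷ []) (q ∷ p ∷ rest))) chord

chord-from-edge : ∀ {n} {G : Graph n} → Leafless G → ∀ {y z} → Edge G y z → ∃[ Q ] Chord G (Q ++ z ∷ y ∷ [])
chord-from-edge {n} {G} leafless {y} {z} eyz =
  grow-chord leafless n z y [] (s≤s (n≤1+n n)) (unique-∷ (λ { (here z≡y) → edge⇒≢ G eyz (sym z≡y) }) ([] ∷ [])) (cons z y [] (edge-sym G eyz) (one y))

module _ {n} {G : Graph n} {P : List (Fin n)} (chord : Chord G P) where
  open Chord chord

  chord-prefix-shape : ∀ pre post → P ≡ pre ++ target ∷ post → ∃[ z ] (pre ≡ head ∷ next ∷ z)
  chord-prefix-shape pre post eq = shape′ pre (trans (sym eq) shape)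
    where
    shape′ : ∀ pre → pre ++ target ∷ post ≡ head ∷ next ∷ rest → ∃[ z ] (pre ≡ head ∷ next ∷ z)
    shape′ []            refl = ⊥-elim (edge-irrefl G edge)
    shape′ (_ ∷ [])      refl = ⊥-elim (target≢next refl)
    shape′ (_ ∷ _ ∷ z)   refl = z , refl

  chord-cycle : ∀ pre post → P ≡ pre ++ target ∷ post → Cycle G
  verts    (chord-cycle pre post eq) = pre ++ target ∷ []
  long     (chord-cycle pre post eq) with chord-prefix-shape pre post eq
  ... | z , refl = s≤s (s≤s (subst (1 ≤_) (sym (length-++ z)) (m≤n+m 1 (length z))))
  distinct (chord-cycle pre post eq) = unique-++ˡ (pre ++ target ∷ []) (subst Unique (trans eq (sym (++-assoc pre (target ∷ []) post))) unique)
  path     (chord-cycle pre post eq) = consecIn⇒isPath _ λ c →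
    isPath-consecIn isPath (subst (λ L → ConsecIn L _ _) (trans (++-assoc pre (target ∷ []) post) (sym eq)) (consecIn-++⁺ˡ post c))
  closing  (chord-cycle pre post eq) fi rs l e₁ e₂ with chord-prefix-shape pre post eq | just-injective (trans (sym e₂) (last-∷ʳ pre target))
  ... | z , refl | refl with e₁
  ... | refl = edge-sym G edge

module _ {n} {G : Graph n} (pf : Pseudoforest G) (leafless : Leafless G) where

  -- Walking away from C along yz must close a cycle D; D is connected to C, hence equal to it, yet D contains yz or misses y.
  leafless-cycle-closed : (C : Cycle G) → ∀ {y z} → y ∈ verts C → Edge G y z → CycleEdge C y z
  leafless-cycle-closed C {y} {z} y∈C eyz with cycleEdgeIn? (verts C) y z
  ... | yes yz∈C = yz∈C
  ... | no yz∉C with chord-from-edge leafless eyz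
  ... | Q , chord with ∈-∃++ (Chord.target∈ chord)
  ... | pre , post , eq = ⊥-elim (by-post post eq)
    where
    open Chord chord
    D : Cycle G
    D = chord-cycle chord pre post eq
    P : List (Fin n)
    P = Q ++ z ∷ y ∷ []
    C≡D : SameCycle C D
    C≡D = pf C D y target y∈C (∈-++⁺ʳ pre (here refl))
            (consecIn-star (edge-sym G) (isPath-consecIn isPath) (∈-++⁺ʳ Q (there (here refl))) target∈)
    by-post : ∀ post → P ≡ pre ++ target ∷ post → ⊥
    by-post [] eq′ with ∷ʳ-injective (Q ++ z ∷ []) pre (trans (++-assoc Q (z ∷ []) (y ∷ [])) eq′)
    ... | refl , refl = yz∉C (proj₂ (C≡D y z) (inj₁ (inj₂ zy∈D)))
      where
      zy∈D : ConsecIn (verts D) z y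
      zy∈D = subst (λ L → ConsecIn L z y) (sym (++-assoc Q (z ∷ []) (y ∷ []))) (consecIn-++⁺ʳ Q (here z y []))
    by-post (w ∷ post′) eq′ = unique-++-disjoint (pre ++ target ∷ []) u′ (sameCycle-∈ {C = C} {D} C≡D y∈C) y∈post
      where
      u′ : Unique ((pre ++ target ∷ []) ++ w ∷ post′)
      u′ = subst Unique (trans eq′ (sym (++-assoc pre (target ∷ []) (w ∷ post′)))) unique
      y∈post : y ∈ w ∷ post′
      y∈post = last-∈ (w ∷ post′) (begin
        last (w ∷ post′)                 ≡⟨ sym (last-++ pre target (w ∷ post′)) ⟩
        last (pre ++ target ∷ w ∷ post′) ≡⟨ cong last (sym eq′) ⟩
        last P                           ≡⟨ cong last (sym (++-assoc Q (z ∷ []) (y ∷ []))) ⟩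
        last ((Q ++ z ∷ []) ++ y ∷ [])   ≡⟨ last-∷ʳ (Q ++ z ∷ []) y ⟩
        just y                           ∎)
        where open ≡-Reasoning

  -- From a vertex u of degree ≥ 3 walk away along one edge until a cycle D closes; some edge at the closing vertex is not on D.
  leafless⇒deg≤2 : ∀ u → ¬ 3 ≤ deg G u
  leafless⇒deg≤2 u d3 with deg≥3⇒three-edges G d3
  ... | x₁ , x₂ , x₃ , e₁ , e₂ , e₃ , x₁≢x₂ , x₁≢x₃ , x₂≢x₃ with chord-from-edge leafless e₁
  ... | Q , chord with ∈-∃++ (Chord.target∈ chord)
  ... | pre , post , eq = by-post post eq
    where
    open Chord chord
    D : Cycle G
    D = chord-cycle chord pre post eq
    P : List (Fin n)
    P = Q ++ x₁ ∷ u ∷ []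
    by-post : ∀ post → P ≡ pre ++ target ∷ post → ⊥
    by-post [] eq′ with ∷ʳ-injective (Q ++ x₁ ∷ []) pre (trans (++-assoc Q (x₁ ∷ []) (u ∷ [])) eq′)
    ... | refl , refl = not-on-D (leafless-cycle-closed D (∈-++⁺ʳ pre (here refl)) ez)
      where
      pick : ∃[ z ] (Edge G u z × z ≢ x₁ × z ≢ head)
      pick with x₂ ≟ head
      ... | yes x₂≡h = x₃ , e₃ , ≢-sym x₁≢x₃ , λ x₃≡h → x₂≢x₃ (trans x₂≡h (sym x₃≡h))
      ... | no x₂≢h  = x₂ , e₂ , ≢-sym x₁≢x₂ , x₂≢h
      z : Fin n
      z = proj₁ pick
      ez : Edge G u z
      ez = proj₁ (proj₂ pick)
      V : List (Fin n)
      V = (Q ++ x₁ ∷ []) ++ u ∷ []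
      uV : Unique V
      uV = subst Unique (sym (++-assoc Q (x₁ ∷ []) (u ∷ []))) unique
      not-on-D : ¬ CycleEdge D u z
      not-on-D (inj₁ (inj₁ c)) = consecIn-last uV (last-∷ʳ (Q ++ x₁ ∷ []) u) c
      not-on-D (inj₁ (inj₂ c)) = proj₁ (proj₂ (proj₂ pick)) (consecIn-pred-unique uV c
        (subst (λ L → ConsecIn L x₁ u) (sym (++-assoc Q (x₁ ∷ []) (u ∷ []))) (consecIn-++⁺ʳ Q (here x₁ u []))))
      not-on-D (inj₂ (fi , l , (rs , e₁′) , e₂′ , inj₁ (_ , z≡f))) =
        proj₂ (proj₂ (proj₂ pick)) (trans z≡f (∷-injectiveˡ (trans (sym e₁′) (trans (++-assoc Q (x₁ ∷ []) (u ∷ [])) shape))))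
      not-on-D (inj₂ (fi , l , (rs , e₁′) , e₂′ , inj₂ (_ , z≡l))) =
        edge⇒≢ G ez (sym (trans z≡l (just-injective (trans (sym e₂′) (last-∷ʳ (Q ++ x₁ ∷ []) u)))))
    by-post (w ∷ post′) eq′ =
      unique-++-disjoint (pre ++ target ∷ []) u′ (proj₂ (cycleEdgeIn-∈ (leafless-cycle-closed D (∈-++⁺ʳ pre (here refl)) ew))) (here refl)
      where
      ew : Edge G target w
      ew = isPath-consecIn isPath (subst (λ L → ConsecIn L target w) (sym eq′) (consecIn-++⁺ʳ pre (here target w post′)))
      u′ : Unique ((pre ++ target ∷ []) ++ w ∷ post′)
      u′ = subst Unique (trans eq′ (sym (++-assoc pre (target ∷ []) (w ∷ post′)))) unique

-- Creating an edge at a given vertex by P-steps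

pStep-sym : ∀ {n} {G H : Graph n} → PStep G H → PStep H G
pStep-sym {G = G} {H} (pfG , pfH , t) = pfH , pfG , twoSwitch-sym {G = G} {H} t

pStep-cong : ∀ {n} {G G′ H H′ : Graph n} → G ≅ G′ → H ≅ H′ → PStep G H → PStep G′ H′
pStep-cong G≅G′ H≅H′ (pfG , pfH , t) = pseudoforest-≅ G≅G′ pfG , pseudoforest-≅ H≅H′ pfH , twoSwitch-cong G≅G′ H≅H′ t

pSteps-sym : ∀ {n} {G H : Graph n} → Star PStep G H → Star PStep H G
pSteps-sym = Closure.reverse pStep-sym

pSteps-from-≅ : ∀ {n} {A A′ B : Graph n} → A ≅ A′ → Star PStep A B → ∃[ B′ ] (Star PStep A′ B′ × B ≅ B′)
pSteps-from-≅ {A′ = A′} A≅A′ ε = A′ , ε , A≅A′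
pSteps-from-≅ A≅A′ (s ◅ rest) = _ , pStep-cong A≅A′ ≅-refl s ◅ rest , ≅-refl

record Rewired {n} (G : Graph n) (v u w : Fin n) : Set where
  field
    graph       : Graph n
    step        : PStep G graph
    sameDegrees : SameDegrees G graph
    new-edge    : Edge graph v w
    keeps       : ∀ {t} → Edge G v t → t ≢ u → Edge graph v t

module _ {n} {G : Graph n} (pf : Pseudoforest G) {v u w x : Fin n} (D : Distinct4 v u w x)
         (evu : Edge G v u) (ewx : Edge G w x) (¬vw : ¬ Edge G v w) (¬ux : ¬ Edge G u x) where

  private
    v≢w : v ≢ w
    v≢w = proj₁ (proj₂ D)
    u≢x : u ≢ x
    u≢x = proj₁ (proj₂ (proj₂ (proj₂ (proj₂ D))))

  rewired-graph : Graph n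
  rewired-graph = switch G v u w x v≢w u≢x

  rewired-sameDegrees : SameDegrees G rewired-graph
  rewired-sameDegrees = switch-sameDegrees G v u w x v≢w u≢x D evu ewx ¬vw ¬ux

  rewire : Pseudoforest rewired-graph → Rewired G v u w
  rewire pf′ = record
    { graph       = rewired-graph
    ; step        = pf , pf′ , (v , u , w , x , switch-twoSwitchAt {G = G} D evu ewx ¬vw ¬ux)
    ; sameDegrees = rewired-sameDegrees
    ; new-edge    = switch⁺ G v u w x v≢w u≢x (inj₂ (inj₁ pair-refl))
    ; keeps       = λ {t} evt t≢u → switch⁺ G v u w x v≢w u≢x
                      (inj₁ (evt , (λ p → t≢u (pair-other (edge⇒≢ G evu) pair-refl p)) , pair-avoid v≢w (proj₁ (proj₂ (proj₂ D)))))
    }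

-- With all degrees at most 2 every graph is a pseudoforest, so any switch will do.
module _ {n} {G : Graph n} (deg≤2 : ∀ z → deg G z ≤ 2) {v u w : Fin n}
         (evu : Edge G v u) (w≢v : w ≢ v) (w≢u : w ≢ u) (¬vw : ¬ Edge G v w) where

  rewire-deg≤2-via : ∀ {x} → Edge G w x → x ≢ u → ¬ Edge G u x → Rewired G v u w
  rewire-deg≤2-via {x} ewx x≢u ¬ux = rewire pf D evu ewx ¬vw ¬ux (deg≤2⇒pseudoforest deg≤2′)
    where
    pf : Pseudoforest G
    pf = deg≤2⇒pseudoforest deg≤2
    D : Distinct4 v u w x
    D = edge⇒≢ G evu , ≢-sym w≢v , (λ { refl → ¬vw (edge-sym G ewx) }) , ≢-sym w≢u , ≢-sym x≢u , edge⇒≢ G ewx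
    deg≤2′ : ∀ z → deg (rewired-graph pf D evu ewx ¬vw ¬ux) z ≤ 2
    deg≤2′ z = subst (_≤ 2) (rewired-sameDegrees pf D evu ewx ¬vw ¬ux z) (deg≤2 z)

  private
    v≢nbr : ∀ {y} → Edge G w y → v ≢ y
    v≢nbr e refl = ¬vw (edge-sym G e)
    too-many : ∀ {a b c} → Edge G u a → Edge G u b → Edge G u c → a ≢ b → a ≢ c → b ≢ c → ⊥
    too-many ea eb ec a≢b a≢c b≢c with deg≤2⇒third-edge G (deg≤2 u) ea eb a≢b ec
    ... | inj₁ c≡a = a≢c (sym c≡a)
    ... | inj₂ c≡b = b≢c (sym c≡b)

  -- Of two neighbours of w, one is neither u nor adjacent to u, else u would have three neighbours.
  rewire-deg≤2 : 2 ≤ deg G w → Rewired G v u w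
  rewire-deg≤2 d2 with deg-pos⇒edge G (≤-trans (s≤s z≤n) d2)
  ... | x₁ , e₁ with deg≥2⇒other-edge G d2 e₁
  ... | x₂ , e₂ , x₂≢x₁ with x₁ ≟ u | T? (adj G u x₁) | x₂ ≟ u | T? (adj G u x₂)
  ... | no x₁≢u | no ¬ux₁ | _ | _ = rewire-deg≤2-via e₁ x₁≢u ¬ux₁
  ... | _ | _ | no x₂≢u | no ¬ux₂ = rewire-deg≤2-via e₂ x₂≢u ¬ux₂
  ... | yes refl | _ | yes refl | _ = ⊥-elim (x₂≢x₁ refl)
  ... | yes refl | _ | no x₂≢u | yes ux₂ = ⊥-elim (too-many (edge-sym G evu) (edge-sym G e₁) ux₂ (≢-sym w≢v) (v≢nbr e₂) (edge⇒≢ G e₂))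
  ... | no x₁≢u | yes ux₁ | yes refl | _ = ⊥-elim (too-many (edge-sym G evu) (edge-sym G e₂) ux₁ (≢-sym w≢v) (v≢nbr e₁) (edge⇒≢ G e₁))
  ... | no _ | yes ux₁ | no _ | yes ux₂ = ⊥-elim (too-many (edge-sym G evu) ux₁ ux₂ (v≢nbr e₁) (v≢nbr e₂) (≢-sym x₂≢x₁))

triangle : ∀ {n} (K : Graph n) {a b c} → Edge K a b → Edge K b c → Edge K c a → a ≢ b → a ≢ c → b ≢ c → Cycle K
verts    (triangle K {a} {b} {c} _ _ _ _ _ _) = a ∷ b ∷ c ∷ []
long     (triangle K _ _ _ _ _ _) = s≤s (s≤s (s≤s z≤n))
distinct (triangle K _ _ _ a≢b a≢c b≢c) = (a≢b ∷ a≢c ∷ []) ∷ (b≢c ∷ []) ∷ [] ∷ []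
path     (triangle K {a} {b} {c} eab ebc _ _ _ _) = cons a b (c ∷ []) eab (cons b c [] ebc (one c))
closing  (triangle K _ _ eca _ _ _) _ _ _ refl refl = eca

square : ∀ {n} (K : Graph n) {a b c d} → Edge K a b → Edge K b c → Edge K c d → Edge K d a → Distinct4 a b c d → Cycle K
verts    (square K {a} {b} {c} {d} _ _ _ _ _) = a ∷ b ∷ c ∷ d ∷ []
long     (square K _ _ _ _ _) = s≤s (s≤s (s≤s z≤n))
distinct (square K _ _ _ _ (a≢b , a≢c , a≢d , b≢c , b≢d , c≢d)) =
  (a≢b ∷ a≢c ∷ a≢d ∷ []) ∷ (b≢c ∷ b≢d ∷ []) ∷ (c≢d ∷ []) ∷ [] ∷ []
path     (square K {a} {b} {c} {d} eab ebc ecd _ _) = cons a b (c ∷ d ∷ []) eab (cons b c (d ∷ []) ebc (cons c d [] ecd (one d)))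
closing  (square K _ _ _ eda _) _ _ _ refl refl = eda

splitAtEdge : ∀ {n} (K : Graph n) a b {s t} → Connected K s t → Connected (removeEdge K a b) s t ⊎ Connected K s a
splitAtEdge K a b ε = inj₁ ε
splitAtEdge K a b (_◅_ {s} {s′} e rest) with pair? s s′ a b
... | yes (inj₁ (refl , refl)) = inj₂ ε
... | yes (inj₂ (refl , refl)) = inj₂ (e ◅ ε)
... | no ¬p with splitAtEdge K a b rest
... | inj₁ c = inj₁ (removeEdge⁺ K a b e ¬p ◅ c)
... | inj₂ c = inj₂ (e ◅ c)

module NeighbourCycles {n} (K : Graph n) (pf : Pseudoforest K) (w : Fin n) where

  CycleBeyond : Fin n → Set
  CycleBeyond x = Σ (Cycle (removeEdge K w x)) λ D → ∃[ p ] (p ∈ verts D × Connected (removeEdge K w x) p x)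

  private
    lift : ∀ x → Cycle (removeEdge K w x) → Cycle K
    lift x = cycle-⊆ (removeEdge-⊆ K w x)

    lift-connected : ∀ x {s t} → Connected (removeEdge K w x) s t → Connected K s t
    lift-connected x = connected-⊆ {G = removeEdge K w x} {K} (removeEdge-⊆ K w x)

  -- Otherwise wx would lie on a cycle in the component of D, which would then have to be D itself.
  cycleBeyond-cut : ∀ {x} → Edge K w x → CycleBeyond x → ¬ Connected (removeEdge K w x) x w
  cycleBeyond-cut {x} ewx (D , p , p∈D , p~x) x~w with edge-on-cycle K ewx x~w
  ... | E , wx∈E = proj₂ (removeEdge⁻ K w x (cycleEdge⇒edge D wx∈D)) pair-refl
    where
    D≡E : SameCycle (lift x D) E
    D≡E = pf (lift x D) E p x p∈D (proj₂ (cycleEdgeIn-∈ wx∈E)) (lift-connected x p~x)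
    wx∈D : CycleEdge D w x
    wx∈D = proj₂ (D≡E w x) wx∈E

  -- A cycle beyond x would be joined to E through wx, hence be E and pass through w, so x would still reach w.
  cycleThrough⇒acyclicBeyond : Σ (Cycle K) (λ E → w ∈ verts E) → ∀ {x} → Edge K w x → AcyclicComponent (removeEdge K w x) x
  cycleThrough⇒acyclicBeyond (E , w∈E) {x} ewx D p p∈D p~x =
    cycleBeyond-cut ewx (D , p , p∈D , p~x) (connected-sym (removeEdge K w x) (cycle-connected D w∈D p∈D ◅◅ p~x))
    where
    E≡D : SameCycle E (lift x D)
    E≡D = pf E (lift x D) w p w∈E p∈D (ewx ◅ connected-sym K (lift-connected x p~x))
    w∈D : w ∈ verts D
    w∈D = sameCycle-∈ {C = E} {lift x D} E≡D w∈E

  -- Two cycles beyond distinct neighbours would lie in one component of K, so they coincide, and w gets connected past x₁.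
  cycleBeyond⇒acyclicBeyond : ∀ {x₁ x₂} → x₁ ≢ x₂ → Edge K w x₁ → Edge K w x₂ → CycleBeyond x₁ → AcyclicComponent (removeEdge K w x₂) x₂
  cycleBeyond⇒acyclicBeyond {x₁} {x₂} x₁≢x₂ e₁ e₂ cb₁@(D₁ , p₁ , p₁∈D₁ , c₁) D₂ p₂ p₂∈D₂ c₂
    with splitAtEdge (removeEdge K w x₂) w x₁ c₂
  ... | inj₂ p₂~w = cycleBeyond-cut e₂ (D₂ , p₂ , p₂∈D₂ , c₂) (connected-sym (removeEdge K w x₂) c₂ ◅◅ p₂~w)
  ... | inj₁ c =
    cycleBeyond-cut e₁ cb₁ (connected-sym (removeEdge K w x₁) c₁ ◅◅ (cycle-connected D₁ p₁∈D₁ p₂∈D₁ ◅◅ (c′ ◅◅ (x₂w ◅ ε))))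
    where
    D₂≡D₁ : SameCycle (lift x₂ D₂) (lift x₁ D₁)
    D₂≡D₁ = pf (lift x₂ D₂) (lift x₁ D₁) p₂ p₁ p₂∈D₂ p₁∈D₁
              (lift-connected x₂ c₂ ◅◅ (edge-sym K e₂ ◅ (e₁ ◅ connected-sym K (lift-connected x₁ c₁))))
    p₂∈D₁ : p₂ ∈ verts D₁
    p₂∈D₁ = sameCycle-∈ {C = lift x₂ D₂} {lift x₁ D₁} D₂≡D₁ p₂∈D₂
    c′ : Connected (removeEdge K w x₁) p₂ x₂
    c′ = connected-⊆ {G = removeEdge (removeEdge K w x₂) w x₁} {removeEdge K w x₁}
           (λ e → let e′ , ¬p = removeEdge⁻ (removeEdge K w x₂) w x₁ e in removeEdge⁺ K w x₁ (removeEdge-⊆ K w x₂ e′) ¬p) c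
    x₂w : Edge (removeEdge K w x₁) x₂ w
    x₂w = removeEdge⁺ K w x₁ (edge-sym K e₂) λ
      { (inj₁ (x₂≡w , _)) → edge⇒≢ K e₂ (sym x₂≡w) ; (inj₂ (x₂≡x₁ , _)) → x₁≢x₂ (sym x₂≡x₁) }

  two-cyclic-neighbours : ∀ {x₁ x₂} → x₁ ≢ x₂ → Edge K w x₁ → Edge K w x₂ →
    ¬ AcyclicComponent (removeEdge K w x₁) x₁ → ¬ AcyclicComponent (removeEdge K w x₂) x₂ → ⊥
  two-cyclic-neighbours x₁≢x₂ e₁ e₂ ¬ac₁ ¬ac₂ =
    ¬ac₁ λ D p p∈D p~x₁ → ¬ac₂ (cycleBeyond⇒acyclicBeyond x₁≢x₂ e₁ e₂ (D , p , p∈D , p~x₁))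

  module _ (u : Fin n) (w≢u : w ≢ u) where

    NearU : Fin n → Set
    NearU x = x ≡ u ⊎ Edge K u x

    square-uw : ∀ {x₁ x₂} → x₁ ≢ x₂ → Edge K w x₁ → Edge K w x₂ → Edge K u x₁ → Edge K u x₂ → Cycle K
    square-uw x₁≢x₂ e₁ e₂ u₁ u₂ =
      square K u₁ (edge-sym K e₁) e₂ (edge-sym K u₂) (edge⇒≢ K u₁ , ≢-sym w≢u , edge⇒≢ K u₂ , ≢-sym (edge⇒≢ K e₁) , x₁≢x₂ , edge⇒≢ K e₂)

    nearU-cycle : ∀ {x₁ x₂} → x₁ ≢ x₂ → Edge K w x₁ → Edge K w x₂ → NearU x₁ → NearU x₂ → Σ (Cycle K) λ E → w ∈ verts E
    nearU-cycle x₁≢x₂ e₁ e₂ (inj₁ refl) (inj₁ refl) = ⊥-elim (x₁≢x₂ refl)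
    nearU-cycle x₁≢x₂ e₁ e₂ (inj₁ refl) (inj₂ u₂) = triangle K e₁ u₂ (edge-sym K e₂) w≢u (edge⇒≢ K e₂) (edge⇒≢ K u₂) , here refl
    nearU-cycle x₁≢x₂ e₁ e₂ (inj₂ u₁) (inj₁ refl) = triangle K e₂ u₁ (edge-sym K e₁) w≢u (edge⇒≢ K e₁) (edge⇒≢ K u₁) , here refl
    nearU-cycle x₁≢x₂ e₁ e₂ (inj₂ u₁) (inj₂ u₂) = square-uw x₁≢x₂ e₁ e₂ u₁ u₂ , there (there (here refl))

    -- The triangles w u x₁ and w u x₂ share w, so they would be the same cycle.
    two-triangles : ∀ {x₁ x₂} → x₁ ≢ x₂ → Edge K w u → Edge K u x₁ → Edge K u x₂ → Edge K w x₁ → Edge K w x₂ → ⊥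
    two-triangles x₁≢x₂ ewu u₁ u₂ e₁ e₂ with proj₂ (cycleEdgeIn-∈ ux₁∈T₂)
      where
      T₁ T₂ : Cycle K
      T₁ = triangle K ewu u₁ (edge-sym K e₁) w≢u (edge⇒≢ K e₁) (edge⇒≢ K u₁)
      T₂ = triangle K ewu u₂ (edge-sym K e₂) w≢u (edge⇒≢ K e₂) (edge⇒≢ K u₂)
      ux₁∈T₂ : CycleEdge T₂ u _
      ux₁∈T₂ = proj₁ (pf T₁ T₂ w w (here refl) (here refl) ε u _) (inj₁ (inj₁ (there w _ u _ (here u _ []))))
    ... | here x₁≡w = edge⇒≢ K e₁ (sym x₁≡w)
    ... | there (here x₁≡u) = edge⇒≢ K u₁ (sym x₁≡u)
    ... | there (there (here x₁≡x₂)) = x₁≢x₂ x₁≡x₂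

    -- The squares u x₁ w x₂ and u x₁ w x₃ share w, so they would be the same cycle.
    ¬three-nearU : ∀ {x₁ x₂ x₃} → x₁ ≢ x₂ → x₁ ≢ x₃ → x₂ ≢ x₃ → Edge K w x₁ → Edge K w x₂ → Edge K w x₃ →
                   NearU x₁ → NearU x₂ → NearU x₃ → ⊥
    ¬three-nearU x₁≢x₂ x₁≢x₃ x₂≢x₃ e₁ e₂ e₃ (inj₁ refl) (inj₁ refl) _ = x₁≢x₂ refl
    ¬three-nearU x₁≢x₂ x₁≢x₃ x₂≢x₃ e₁ e₂ e₃ (inj₁ refl) _ (inj₁ refl) = x₁≢x₃ refl
    ¬three-nearU x₁≢x₂ x₁≢x₃ x₂≢x₃ e₁ e₂ e₃ _ (inj₁ refl) (inj₁ refl) = x₂≢x₃ refl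
    ¬three-nearU x₁≢x₂ x₁≢x₃ x₂≢x₃ e₁ e₂ e₃ (inj₁ refl) (inj₂ u₂) (inj₂ u₃) = two-triangles x₂≢x₃ e₁ u₂ u₃ e₂ e₃
    ¬three-nearU x₁≢x₂ x₁≢x₃ x₂≢x₃ e₁ e₂ e₃ (inj₂ u₁) (inj₁ refl) (inj₂ u₃) = two-triangles x₁≢x₃ e₂ u₁ u₃ e₁ e₃
    ¬three-nearU x₁≢x₂ x₁≢x₃ x₂≢x₃ e₁ e₂ e₃ (inj₂ u₁) (inj₂ u₂) (inj₁ refl) = two-triangles x₁≢x₂ e₃ u₁ u₂ e₁ e₂
    ¬three-nearU {x₁} {x₂} {x₃} x₁≢x₂ x₁≢x₃ x₂≢x₃ e₁ e₂ e₃ (inj₂ u₁) (inj₂ u₂) (inj₂ u₃)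
      with proj₂ (cycleEdgeIn-∈ wx₂∈S₃)
      where
      S₂ S₃ : Cycle K
      S₂ = square-uw x₁≢x₂ e₁ e₂ u₁ u₂
      S₃ = square-uw x₁≢x₃ e₁ e₃ u₁ u₃
      wx₂∈S₃ : CycleEdge S₃ w x₂
      wx₂∈S₃ = proj₁ (pf S₂ S₃ w w (there (there (here refl))) (there (there (here refl))) ε w x₂)
                     (inj₁ (inj₁ (there u _ w x₂ (there x₁ _ w x₂ (here w x₂ [])))))
    ... | here x₂≡u = edge⇒≢ K u₂ (sym x₂≡u)
    ... | there (here x₂≡x₁) = x₁≢x₂ (sym x₂≡x₁)
    ... | there (there (here x₂≡w)) = edge⇒≢ K e₂ (sym x₂≡w)
    ... | there (there (there (here x₂≡x₃))) = x₂≢x₃ x₂≡x₃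

    Blocked : Fin n → Set
    Blocked x = NearU x ⊎ ¬ AcyclicComponent (removeEdge K w x) x

    module _ {x₁ x₂ x₃} (x₁≢x₂ : x₁ ≢ x₂) (x₁≢x₃ : x₁ ≢ x₃) (x₂≢x₃ : x₂ ≢ x₃)
             (e₁ : Edge K w x₁) (e₂ : Edge K w x₂) (e₃ : Edge K w x₃) where

      ¬three-blocked : Blocked x₁ → Blocked x₂ → Blocked x₃ → ⊥
      ¬three-blocked (inj₁ b₁) (inj₁ b₂) (inj₁ b₃)   = ¬three-nearU x₁≢x₂ x₁≢x₃ x₂≢x₃ e₁ e₂ e₃ b₁ b₂ b₃
      ¬three-blocked (inj₁ b₁) (inj₁ b₂) (inj₂ ¬ac₃) = ¬ac₃ (cycleThrough⇒acyclicBeyond (nearU-cycle x₁≢x₂ e₁ e₂ b₁ b₂) e₃)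
      ¬three-blocked (inj₁ b₁) (inj₂ ¬ac₂) (inj₁ b₃) = ¬ac₂ (cycleThrough⇒acyclicBeyond (nearU-cycle x₁≢x₃ e₁ e₃ b₁ b₃) e₂)
      ¬three-blocked (inj₂ ¬ac₁) (inj₁ b₂) (inj₁ b₃) = ¬ac₁ (cycleThrough⇒acyclicBeyond (nearU-cycle x₂≢x₃ e₂ e₃ b₂ b₃) e₁)
      ¬three-blocked _ (inj₂ ¬ac₂) (inj₂ ¬ac₃)       = two-cyclic-neighbours x₂≢x₃ e₂ e₃ ¬ac₂ ¬ac₃
      ¬three-blocked (inj₂ ¬ac₁) _ (inj₂ ¬ac₃)       = two-cyclic-neighbours x₁≢x₃ e₁ e₃ ¬ac₁ ¬ac₃
      ¬three-blocked (inj₂ ¬ac₁) (inj₂ ¬ac₂) _       = two-cyclic-neighbours x₁≢x₂ e₁ e₂ ¬ac₁ ¬ac₂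

module HighDegreeTarget {n} {G : Graph n} (pf : Pseudoforest G) {v u w : Fin n} (dv : deg G v ≡ 1) (evu : Edge G v u)
                        (w≢u : w ≢ u) (w≢v : w ≢ v) (¬vw : ¬ Edge G v w) where

  private
    K : Graph n
    K = removeEdge G v u

    pfK : Pseudoforest K
    pfK = pseudoforest-⊆ (removeEdge-⊆ G v u) pf

    v≢nbr : ∀ {x} → Edge G w x → v ≢ x
    v≢nbr e refl = ¬vw (edge-sym G e)

    edgeK : ∀ {x} → Edge G w x → Edge K w x
    edgeK e = removeEdge⁺ G v u e (pair-avoid w≢v w≢u)

  open NeighbourCycles K pfK w

  -- The switch turns K into K - wx + ux + vw; there vw is a pendant edge, and ux joins x's acyclic component to K.
  switch-pseudoforest : ∀ {x} (v≢w : v ≢ w) (u≢x : u ≢ x) → Edge G w x → AcyclicComponent (removeEdge K w x) x →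
                        Pseudoforest (switch G v u w x v≢w u≢x)
  switch-pseudoforest {x} v≢w u≢x ewx acyclic =
    pseudoforest-addPendant v≢w (pseudoforest-addEdge u≢x (pseudoforest-⊆ (removeEdge-⊆ K w x) pfK) acyclic) v-isolated
    where
    v-isolated : deg (addEdge (removeEdge K w x) u x u≢x) v ≡ 0
    v-isolated = begin
      deg (addEdge (removeEdge K w x) u x u≢x) v ≡⟨ deg-addEdge-other (removeEdge K w x) u≢x (edge⇒≢ G evu) (v≢nbr ewx) ⟩
      deg (removeEdge K w x) v                   ≡⟨ deg-removeEdge-other K v≢w (v≢nbr ewx) ⟩
      deg K v                                    ≡⟨ suc-injective (trans (sym (deg-removeEdge-end G pair-refl evu)) dv) ⟩
      0                                          ∎
      where open ≡-Reasoning

  -- Deciding whether the switched graph is a pseudoforest is what makes this case analysis constructive.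
  try : ∀ {x} → Edge G w x → Rewired G v u w ⊎ Blocked u w≢u x
  try {x} ewx with x ≟ u | T? (adj G u x)
  ... | yes x≡u | _ = inj₂ (inj₁ (inj₁ x≡u))
  ... | no x≢u | yes eux = inj₂ (inj₁ (inj₂ (removeEdge⁺ G v u eux λ
    { (inj₁ (u≡v , _)) → edge⇒≢ G evu (sym u≡v) ; (inj₂ (_ , x≡v)) → v≢nbr ewx (sym x≡v) })))
  ... | no x≢u | no ¬ux with pseudoforest? (switch G v u w x (≢-sym w≢v) (≢-sym x≢u))
  ... | yes pf′ = inj₁ (rewire pf D evu ewx ¬vw ¬ux pf′)
    where
    D : Distinct4 v u w x
    D = edge⇒≢ G evu , ≢-sym w≢v , v≢nbr ewx , ≢-sym w≢u , ≢-sym x≢u , edge⇒≢ G ewx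
  ... | no ¬pf′ = inj₂ (inj₂ (¬pf′ ∘ switch-pseudoforest (≢-sym w≢v) (≢-sym x≢u) ewx))

  -- x blocks the switch if it is u or adjacent to u, or if a cycle lies beyond wx; three blocked neighbours are impossible.
  rewire-deg≥3 : 3 ≤ deg G w → Rewired G v u w
  rewire-deg≥3 d3 with deg≥3⇒three-edges G d3
  ... | x₁ , x₂ , x₃ , e₁ , e₂ , e₃ , x₁≢x₂ , x₁≢x₃ , x₂≢x₃ with try e₁ | try e₂ | try e₃
  ... | inj₁ r | _ | _ = r
  ... | _ | inj₁ r | _ = r
  ... | _ | _ | inj₁ r = r
  ... | inj₂ b₁ | inj₂ b₂ | inj₂ b₃ = ⊥-elim (¬three-blocked u w≢u x₁≢x₂ x₁≢x₃ x₂≢x₃ (edgeK e₁) (edgeK e₂) (edgeK e₃) b₁ b₂ b₃)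

record Attached {n} (G : Graph n) (v w : Fin n) : Set where
  field
    graph        : Graph n
    steps        : Star PStep G graph
    pseudoforest : Pseudoforest graph
    sameDegrees  : SameDegrees G graph
    edge         : Edge graph v w

rewired⇒attached : ∀ {n} {G : Graph n} {v u w} → Rewired G v u w → Attached G v w
rewired⇒attached r = record
  { graph = graph ; steps = step ◅ ε ; pseudoforest = proj₁ (proj₂ step) ; sameDegrees = sameDegrees ; edge = new-edge }
  where open Rewired r

module _ {n} {G : Graph n} (pf : Pseudoforest G) {v w : Fin n} (dv : deg G v ≡ 1) (w≢v : w ≢ v)
         (maximal : ∀ y → y ≢ v → deg G y ≤ deg G w) {u : Fin n} (evu : Edge G v u) (u≢w : u ≢ w) where

  private
    ¬vw : ¬ Edge G v w
    ¬vw = u≢w ∘ deg≤1⇒unique-edge G (≤-reflexive dv) evu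

    du≤dw : deg G u ≤ deg G w
    du≤dw = maximal u (edge⇒≢ G evu ∘ sym)

    deg≤2 : deg G w ≤ 2 → ∀ z → deg G z ≤ 2
    deg≤2 dw≤2 z with z ≟ v
    ... | yes refl = ≤-trans (≤-reflexive dv) (s≤s z≤n)
    ... | no z≢v   = ≤-trans (maximal z z≢v) dw≤2

  -- With deg w = 1 the graph is a matching plus v, and w's partner x is a valid choice.
  rewire-deg≤1 : deg G w ≤ 1 → Rewired G v u w
  rewire-deg≤1 dw≤1 with deg-pos⇒edge G (≤-trans (edge⇒deg-pos G (edge-sym G evu)) du≤dw)
  ... | x , ewx = rewire-deg≤2-via (deg≤2 (≤-trans dw≤1 (s≤s z≤n))) evu w≢v (≢-sym u≢w) ¬vw ewx x≢u ¬ux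
    where
    du≤1 : deg G u ≤ 1
    du≤1 = ≤-trans du≤dw dw≤1
    x≢u : x ≢ u
    x≢u refl = w≢v (deg≤1⇒unique-edge G du≤1 (edge-sym G ewx) (edge-sym G evu))
    ¬ux : ¬ Edge G u x
    ¬ux eux with deg≤1⇒unique-edge G du≤1 eux (edge-sym G evu)
    ... | refl = ¬vw (edge-sym G ewx)

  rewire-leaf : Rewired G v u w
  rewire-leaf with deg G w ≤? 2 | 2 ≤? deg G w
  ... | no dw≰2  | _        = HighDegreeTarget.rewire-deg≥3 pf dv evu (≢-sym u≢w) w≢v ¬vw (≰⇒> dw≰2)
  ... | yes dw≤2 | yes dw≥2 = rewire-deg≤2 (deg≤2 dw≤2) evu w≢v (≢-sym u≢w) ¬vw dw≥2
  ... | yes _    | no dw≱2  = rewire-deg≤1 (≤-pred (≰⇒> dw≱2))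

-- Choosing w of maximum degree makes the neighbour u of the leaf v no bigger than w, which is what the small cases need.
attach-leaf : ∀ {n} {G : Graph n} → Pseudoforest G → ∀ {v w} → deg G v ≡ 1 → w ≢ v →
              (∀ y → y ≢ v → deg G y ≤ deg G w) → Attached G v w
attach-leaf {G = G} pf {v} {w} dv w≢v maximal with deg-pos⇒edge G (≤-reflexive (sym dv))
... | u , evu with u ≟ w
... | yes refl = record { graph = G ; steps = ε ; pseudoforest = pf ; sameDegrees = λ _ → refl ; edge = evu }
... | no u≢w   = rewired⇒attached (rewire-leaf pf dv w≢v maximal evu u≢w)

attach-both : ∀ {n} {G : Graph n} → (∀ z → deg G z ≤ 2) → ∀ {v w₁ w₂} → deg G v ≡ 2 → w₁ ≢ v → w₂ ≢ v → w₂ ≢ w₁ →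
              2 ≤ deg G w₁ → 2 ≤ deg G w₂ → ∃[ G₂ ] (Star PStep G G₂ × SameDegrees G G₂ × Edge G₂ v w₁ × Edge G₂ v w₂)
attach-both {G = G} deg≤2 {v} {w₁} {w₂} dv w₁≢v w₂≢v w₂≢w₁ dw₁ dw₂ = second first
  where
  first : Attached G v w₁
  first with T? (adj G v w₁)
  ... | yes e = record { graph = G ; steps = ε ; pseudoforest = deg≤2⇒pseudoforest deg≤2 ; sameDegrees = λ _ → refl ; edge = e }
  ... | no ¬e with deg-pos⇒edge G (≤-trans (s≤s z≤n) (≤-reflexive (sym dv)))
  ... | u , evu = rewired⇒attached (rewire-deg≤2 deg≤2 evu w₁≢v w₁≢u ¬e dw₁)
    where
    w₁≢u : w₁ ≢ u
    w₁≢u refl = ¬e evu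
  second : Attached G v w₁ → ∃[ G₂ ] (Star PStep G G₂ × SameDegrees G G₂ × Edge G₂ v w₁ × Edge G₂ v w₂)
  second record { graph = G₁ ; steps = G→G₁ ; sameDegrees = sd₁ ; edge = e₁ } with T? (adj G₁ v w₂)
  ... | yes e₂ = G₁ , G→G₁ , sd₁ , e₁ , e₂
  ... | no ¬e₂ with deg≥2⇒other-edge G₁ (subst (2 ≤_) (trans (sym dv) (sd₁ v)) ≤-refl) e₁
  ... | u , evu , u≢w₁ = R.graph , G→G₁ ◅◅ (R.step ◅ ε) , (λ z → trans (sd₁ z) (R.sameDegrees z)) , R.keeps e₁ (≢-sym u≢w₁) , R.new-edge
    where
    deg≤2′ : ∀ z → deg G₁ z ≤ 2
    deg≤2′ z = subst (_≤ 2) (sd₁ z) (deg≤2 z)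
    w₂≢u : w₂ ≢ u
    w₂≢u refl = ¬e₂ evu
    module R = Rewired (rewire-deg≤2 deg≤2′ evu w₂≢v w₂≢u ¬e₂ (subst (2 ≤_) (sd₁ w₂) dw₂))

-- The induction

removeEdge-sameDegrees : ∀ {n} {X A : Graph n} {v w} → SameDegrees X A → Edge X v w → Edge A v w →
                         SameDegrees (removeEdge X v w) (removeEdge A v w)
removeEdge-sameDegrees {X = X} {A} {v} {w} sd eX eA z with z ≟ v | z ≟ w
... | yes refl | _ = suc-injective (trans (sym (deg-removeEdge-end X pair-refl eX)) (trans (sd z) (deg-removeEdge-end A pair-refl eA)))
... | no _ | yes refl = suc-injective (trans (sym (deg-removeEdge-end X (pair-sym pair-refl) eX)) (trans (sd z) (deg-removeEdge-end A (pair-sym pair-refl) eA)))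
... | no z≢v | no z≢w = trans (deg-removeEdge-other X z≢v z≢w) (trans (sd z) (sym (deg-removeEdge-other A z≢v z≢w)))

addEdge-sameDegrees : ∀ {n} {X A : Graph n} {v w} (v≢w : v ≢ w) → SameDegrees X A → ¬ Edge X v w → ¬ Edge A v w →
                      SameDegrees (addEdge X v w v≢w) (addEdge A v w v≢w)
addEdge-sameDegrees {X = X} {A} {v} {w} v≢w sd ¬X ¬A z with z ≟ v | z ≟ w
... | yes refl | _ = trans (deg-addEdge-end X v≢w pair-refl ¬X) (trans (cong suc (sd z)) (sym (deg-addEdge-end A v≢w pair-refl ¬A)))
... | no _ | yes refl = trans (deg-addEdge-end X v≢w (pair-sym pair-refl) ¬X) (trans (cong suc (sd z)) (sym (deg-addEdge-end A v≢w (pair-sym pair-refl) ¬A)))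
... | no z≢v | no z≢w = trans (deg-addEdge-other X v≢w z≢v z≢w) (trans (sd z) (sym (deg-addEdge-other A v≢w z≢v z≢w)))

addEdge-cong : ∀ {n} {v w : Fin n} (v≢w : v ≢ w) {X Y : Graph n} → X ≅ Y → addEdge X v w v≢w ≅ addEdge Y v w v≢w
addEdge-cong {v = v} {w} v≢w X≅Y = ≅-intro (move X≅Y) (move (≅-sym X≅Y))
  where
  move : ∀ {X Y} → X ≅ Y → ∀ {x y} → Edge (addEdge X v w v≢w) x y → Edge (addEdge Y v w v≢w) x y
  move {X} {Y} X≅Y e = [ addEdge⁺ˡ Y v w v≢w ∘ ≅-edge X≅Y , addEdge⁺ʳ Y v w v≢w ]′ (addEdge⁻ X v w v≢w e)

addEdge-removeEdge : ∀ {n} (G : Graph n) {v w} (v≢w : v ≢ w) → Edge G v w → addEdge (removeEdge G v w) v w v≢w ≅ G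
addEdge-removeEdge G {v} {w} v≢w evw = ≅-intro to from
  where
  to : ∀ {x y} → Edge (addEdge (removeEdge G v w) v w v≢w) x y → Edge G x y
  to e = [ removeEdge-⊆ G v w , (λ p → pair-edge G p evw) ]′ (addEdge⁻ (removeEdge G v w) v w v≢w e)
  from : ∀ {x y} → Edge G x y → Edge (addEdge (removeEdge G v w) v w v≢w) x y
  from {x} {y} e = by-cases (pair? x y v w)
    where
    by-cases : Dec (Pair x y v w) → Edge (addEdge (removeEdge G v w) v w v≢w) x y
    by-cases (yes p) = addEdge⁺ʳ (removeEdge G v w) v w v≢w p
    by-cases (no ¬p) = addEdge⁺ˡ (removeEdge G v w) v w v≢w (removeEdge⁺ G v w e ¬p)

pSteps-lift : ∀ {n} (F : Graph n → Graph n) {A : Graph n} →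
  (∀ {X} → SameDegrees A X → Pseudoforest X → Pseudoforest (F X)) →
  (∀ {X Y} → SameDegrees A X → TwoSwitch X Y → TwoSwitch (F X) (F Y)) →
  ∀ {X Y} → SameDegrees A X → Star PStep X Y → Star PStep (F X) (F Y)
pSteps-lift F lift-pf lift-switch sd ε = ε
pSteps-lift F {A} lift-pf lift-switch {X} sd (_◅_ {j = Y} (pfX , pfY , t) rest) =
  (lift-pf {X} sd pfX , lift-pf {Y} sdY pfY , lift-switch {X} {Y} sd t) ◅ pSteps-lift F {A} lift-pf lift-switch sdY rest
  where
  sdY : SameDegrees A Y
  sdY z = trans (sd z) (twoSwitch⇒sameDegrees {G = X} {Y} t z)

positive : ℕ → Bool
positive zero    = false
positive (suc _) = true

nonIsolated : ∀ {n} → Graph n → ℕ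
nonIsolated G = count (λ z → positive (deg G z))

nonIsolated-sameDegrees : ∀ {n} {G H : Graph n} → SameDegrees G H → nonIsolated G ≡ nonIsolated H
nonIsolated-sameDegrees sd = count-cong (cong positive ∘ sd)

nonIsolated≤0⇒isolated : ∀ {n} (G : Graph n) → nonIsolated G ≤ 0 → ∀ z → deg G z ≡ 0
nonIsolated≤0⇒isolated G μ≤0 z with deg G z in dz | count-zero (λ z → positive (deg G z)) (≤0 μ≤0) z
  where
  ≤0 : ∀ {m} → m ≤ 0 → m ≡ 0
  ≤0 z≤n = refl
... | zero  | _   = refl
... | suc _ | ¬pos = ⊥-elim (¬pos tt)

nonIsolated-< : ∀ {n} {R G : Graph n} → (∀ {x y} → Edge R x y → Edge G x y) → ∀ {v} → deg R v ≡ 0 → 1 ≤ deg G v →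
                nonIsolated R < nonIsolated G
nonIsolated-< {R = R} {G} R⊆G {v} dR dG = count-< v grows (subst (¬_ ∘ T ∘ positive) (sym dR) λ ()) (positive-≥1 dG)
  where
  positive-≥1 : ∀ {d} → 1 ≤ d → T (positive d)
  positive-≥1 (s≤s _) = tt
  grows : ∀ z → T (positive (deg R z)) → T (positive (deg G z))
  grows z t with deg R z in dz
  ... | suc _ = let y , e = deg-pos⇒edge R (subst (1 ≤_) (sym dz) (s≤s z≤n)) in positive-≥1 (edge⇒deg-pos G (R⊆G e))

argmax-except : ∀ {n} (f : Fin n → ℕ) {v u : Fin n} → u ≢ v → ∃[ w ] (w ≢ v × (∀ y → y ≢ v → f y ≤ f w))
argmax-except {n} f {v} {u} u≢v =
  argmax f u others , argmax-all f u≢v (all-filter (¬? ∘ (_≟ v)) (allFin n)) ,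
  λ y y≢v → lookup (f[xs]≤f[argmax] u others) (∈-filter⁺ (¬? ∘ (_≟ v)) (∈-allFin y) y≢v)
  where
  others : List (Fin n)
  others = filter (¬? ∘ (_≟ v)) (allFin n)

isolated⇒≅ : ∀ {n} {G H : Graph n} → (∀ z → deg G z ≡ 0) → SameDegrees G H → G ≅ H
isolated⇒≅ {G = G} {H} isolated sd = ≅-intro (⊥-elim ∘ deg-zero G (isolated _)) (⊥-elim ∘ deg-zero H (trans (sym (sd _)) (isolated _)))

Reconfigurable : ∀ {n} → Graph n → Graph n → Set
Reconfigurable G H = ∃[ K ] (Star PStep G K × K ≅ H)

reconfigurable-extend : ∀ {n} {G G′ H H′ : Graph n} → Star PStep G G′ → Star PStep H H′ → Reconfigurable G′ H′ → Reconfigurable G H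
reconfigurable-extend G→G′ H→H′ (K , G′→K , K≅H′) with pSteps-from-≅ (≅-sym K≅H′) (pSteps-sym H→H′)
... | B , K→B , H≅B = B , G→G′ ◅◅ (G′→K ◅◅ K→B) , ≅-sym H≅B

ReconfigurableBelow : ∀ {n} → ℕ → Set
ReconfigurableBelow {n} k = ∀ (G H : Graph n) → nonIsolated G ≤ k → Pseudoforest G → Pseudoforest H → SameDegrees G H → Reconfigurable G H

module _ {n} {k} (IH : ReconfigurableBelow {n} k) where

  -- G and H arise from smaller RG, RH by the same operation F, which carries P-walks from RG along.
  reconfigure-peeled : (F : Graph n → Graph n) {G H RG RH : Graph n} →
    (∀ {X} → SameDegrees RG X → Pseudoforest X → Pseudoforest (F X)) →
    (∀ {X Y} → SameDegrees RG X → TwoSwitch X Y → TwoSwitch (F X) (F Y)) →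
    (∀ {X Y} → X ≅ Y → F X ≅ F Y) →
    F RG ≅ G → F RH ≅ H → nonIsolated RG ≤ k → Pseudoforest RG → Pseudoforest RH → SameDegrees RG RH → Reconfigurable G H
  reconfigure-peeled F {RG = RG} {RH} lift-pf lift-switch F-cong FRG≅G FRH≅H μ≤k pfRG pfRH sd with IH RG RH μ≤k pfRG pfRH sd
  ... | K , RG→K , K≅RH with pSteps-from-≅ FRG≅G (pSteps-lift F {RG} lift-pf lift-switch (λ _ → refl) RG→K)
  ... | B , G→B , FK≅B = B , G→B , ≅-trans (≅-sym FK≅B) (≅-trans (F-cong K≅RH) FRH≅H)

  reconfigure-pendant : ∀ (G H : Graph n) {v w} (v≢w : v ≢ w) → nonIsolated G ≤ suc k → Pseudoforest G → Pseudoforest H →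
                        SameDegrees G H → deg G v ≡ 1 → Edge G v w → Edge H v w → Reconfigurable G H
  reconfigure-pendant G H {v} {w} v≢w μ≤ pfG pfH sd dv eG eH =
    reconfigure-peeled F {RG = RG} {removeEdge H v w} (λ {X} → lift-pf {X}) (λ {X} {Y} → lift-switch {X} {Y}) (addEdge-cong v≢w)
      (addEdge-removeEdge G v≢w eG) (addEdge-removeEdge H v≢w eH) μ≤k
      (pseudoforest-⊆ (removeEdge-⊆ G v w) pfG) (pseudoforest-⊆ (removeEdge-⊆ H v w) pfH)
      (removeEdge-sameDegrees {X = G} {H} sd eG eH)
    where
    RG : Graph n
    RG = removeEdge G v w
    F : Graph n → Graph n
    F X = addEdge X v w v≢w
    v-isolated : deg RG v ≡ 0
    v-isolated = suc-injective (trans (sym (deg-removeEdge-end G pair-refl eG)) dv)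
    lift-pf : ∀ {X} → SameDegrees RG X → Pseudoforest X → Pseudoforest (F X)
    lift-pf sdX pfX = pseudoforest-addPendant v≢w pfX (trans (sym (sdX v)) v-isolated)
    lift-switch : ∀ {X Y} → SameDegrees RG X → TwoSwitch X Y → TwoSwitch (F X) (F Y)
    lift-switch {X} {Y} sdX t =
      twoSwitchAvoiding⇒twoSwitch (twoSwitchAvoiding-addEdge (twoSwitch-avoids-isolated {G = X} {Y} (trans (sym (sdX v)) v-isolated) t) w v≢w)
    μ≤k : nonIsolated RG ≤ k
    μ≤k = ≤-pred (≤-trans (nonIsolated-< {R = RG} {G} (removeEdge-⊆ G v w) v-isolated (edge⇒deg-pos G eG)) μ≤)

  -- With maximum degree 2, re-adding two edges at an isolated vertex cannot create a degree above 2.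
  reconfigure-two-edges : ∀ (G H : Graph n) {v w₁ w₂} → w₂ ≢ w₁ → nonIsolated G ≤ suc k → (∀ z → deg G z ≤ 2) →
                          Pseudoforest H → SameDegrees G H → deg G v ≡ 2 →
                          Edge G v w₁ → Edge G v w₂ → Edge H v w₁ → Edge H v w₂ → Reconfigurable G H
  reconfigure-two-edges G H {v} {w₁} {w₂} w₂≢w₁ μ≤ deg≤2 pfH sd dv eG₁ eG₂ eH₁ eH₂ =
    reconfigure-peeled F {RG = RG} {removeEdges H} (λ {X} → lift-pf {X}) (λ {X} {Y} → lift-switch {X} {Y}) (λ {X} {Y} → F-cong {X} {Y})
      (restore G eG₁ eG₂) (restore H eH₁ eH₂) μ≤k
      (pseudoforest-⊆ (removeEdges-⊆ G) (deg≤2⇒pseudoforest {G = G} deg≤2)) (pseudoforest-⊆ (removeEdges-⊆ H) pfH)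
      (removeEdge-sameDegrees {X = removeEdge G v w₂} {removeEdge H v w₂} (removeEdge-sameDegrees {X = G} {H} sd eG₂ eH₂)
        (removeEdge⁺ G v w₂ eG₁ ¬vw₁-vw₂) (removeEdge⁺ H v w₂ eH₁ ¬vw₁-vw₂))
    where
    v≢w₁ : v ≢ w₁
    v≢w₁ = edge⇒≢ G eG₁
    v≢w₂ : v ≢ w₂
    v≢w₂ = edge⇒≢ G eG₂
    ¬vw₁-vw₂ : ¬ Pair v w₁ v w₂
    ¬vw₁-vw₂ (inj₁ (_ , w₁≡w₂)) = w₂≢w₁ (sym w₁≡w₂)
    ¬vw₁-vw₂ (inj₂ (v≡w₂ , _))  = v≢w₂ v≡w₂
    removeEdges : Graph n → Graph n
    removeEdges X = removeEdge (removeEdge X v w₂) v w₁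
    removeEdges-⊆ : ∀ X {x y} → Edge (removeEdges X) x y → Edge X x y
    removeEdges-⊆ X = removeEdge-⊆ X v w₂ ∘ removeEdge-⊆ (removeEdge X v w₂) v w₁
    RG : Graph n
    RG = removeEdges G
    F : Graph n → Graph n
    F X = addEdge (addEdge X v w₁ v≢w₁) v w₂ v≢w₂
    F-cong : ∀ {X Y} → X ≅ Y → F X ≅ F Y
    F-cong = addEdge-cong v≢w₂ ∘ addEdge-cong v≢w₁
    restore : ∀ X → Edge X v w₁ → Edge X v w₂ → F (removeEdges X) ≅ X
    restore X e₁ e₂ = ≅-trans (addEdge-cong v≢w₂ (addEdge-removeEdge (removeEdge X v w₂) v≢w₁ (removeEdge⁺ X v w₂ e₁ ¬vw₁-vw₂)))
                              (addEdge-removeEdge X v≢w₂ e₂)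
    v-isolated : deg RG v ≡ 0
    v-isolated = suc-injective (suc-injective (begin
      suc (suc (deg RG v))            ≡⟨ cong suc (sym (deg-removeEdge-end (removeEdge G v w₂) pair-refl (removeEdge⁺ G v w₂ eG₁ ¬vw₁-vw₂))) ⟩
      suc (deg (removeEdge G v w₂) v) ≡⟨ sym (deg-removeEdge-end G pair-refl eG₂) ⟩
      deg G v                         ≡⟨ dv ⟩
      2                               ∎))
      where open ≡-Reasoning
    no-first : ∀ {Y} → deg Y v ≡ 0 → ¬ Edge Y v w₁
    no-first {Y} d0 = deg-zero Y d0
    no-second : ∀ {Y} → deg Y v ≡ 0 → ¬ Edge (addEdge Y v w₁ v≢w₁) v w₂
    no-second {Y} d0 e with addEdge⁻ Y v w₁ v≢w₁ e
    ... | inj₁ e′ = deg-zero Y d0 e′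
    ... | inj₂ (inj₁ (_ , w₂≡w₁)) = w₂≢w₁ w₂≡w₁
    ... | inj₂ (inj₂ (v≡w₁ , _))  = v≢w₁ v≡w₁
    lift-pf : ∀ {X} → SameDegrees RG X → Pseudoforest X → Pseudoforest (F X)
    lift-pf {X} sdX _ = deg≤2⇒pseudoforest λ z →
      subst (_≤ 2) (trans (sym (≅⇒sameDegrees (restore G eG₁ eG₂) z)) (lifted-degrees z)) (deg≤2 z)
      where
      v-isolatedX : deg X v ≡ 0
      v-isolatedX = trans (sym (sdX v)) v-isolated
      lifted-degrees : SameDegrees (F RG) (F X)
      lifted-degrees = addEdge-sameDegrees {X = addEdge RG v w₁ v≢w₁} {addEdge X v w₁ v≢w₁} v≢w₂
        (addEdge-sameDegrees {X = RG} {X} v≢w₁ sdX (no-first {RG} v-isolated) (no-first {X} v-isolatedX))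
        (no-second {RG} v-isolated) (no-second {X} v-isolatedX)
    lift-switch : ∀ {X Y} → SameDegrees RG X → TwoSwitch X Y → TwoSwitch (F X) (F Y)
    lift-switch {X} {Y} sdX t = twoSwitchAvoiding⇒twoSwitch
      (twoSwitchAvoiding-addEdge (twoSwitchAvoiding-addEdge (twoSwitch-avoids-isolated {G = X} {Y} (trans (sym (sdX v)) v-isolated) t) w₁ v≢w₁) w₂ v≢w₂)
    μ≤k : nonIsolated RG ≤ k
    μ≤k = ≤-pred (≤-trans (nonIsolated-< {R = RG} {G} (removeEdges-⊆ G) v-isolated (edge⇒deg-pos G eG₁)) μ≤)

  -- Move the leaf v onto the same vertex w in G and in H.
  leaf-case : ∀ (G H : Graph n) → nonIsolated G ≤ suc k → Pseudoforest G → Pseudoforest H → SameDegrees G H →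
              ∀ {v} → deg G v ≡ 1 → Reconfigurable G H
  leaf-case G H μ≤ pfG pfH sd {v} dv with deg-pos⇒edge G (≤-reflexive (sym dv))
  ... | u , evu with argmax-except (deg G) {v} {u} (edge⇒≢ G evu ∘ sym)
  ... | w , w≢v , maximal =
    reconfigurable-extend G.steps H.steps
      (reconfigure-pendant G.graph H.graph (≢-sym w≢v) (subst (_≤ suc k) (nonIsolated-sameDegrees {G = G} {G.graph} G.sameDegrees) μ≤)
        G.pseudoforest H.pseudoforest (λ z → trans (sym (G.sameDegrees z)) (trans (sd z) (H.sameDegrees z)))
        (trans (sym (G.sameDegrees v)) dv) G.edge H.edge)
    where
    module G = Attached (attach-leaf pfG dv w≢v maximal)
    module H = Attached (attach-leaf pfH (trans (sym (sd v)) dv) w≢v λ y y≢v → subst₂ _≤_ (sd y) (sd w) (maximal y y≢v))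

  -- Every non-isolated vertex has degree 2: give v in G the two neighbours it has in H.
  cycle-case : ∀ (G H : Graph n) → nonIsolated G ≤ suc k → Pseudoforest H → SameDegrees G H →
               (∀ z → deg G z ≤ 2) → Leafless G → ∀ {v} → deg G v ≡ 2 → Reconfigurable G H
  cycle-case G H μ≤ pfH sd deg≤2 leafless {v} dv with deg-pos⇒edge H (subst (1 ≤_) (trans (sym dv) (sd v)) (s≤s z≤n))
  ... | w₁ , ew₁ with deg≥2⇒other-edge H (subst (2 ≤_) (trans (sym dv) (sd v)) ≤-refl) ew₁
  ... | w₂ , ew₂ , w₂≢w₁
    with attach-both {G = G} deg≤2 dv (edge⇒≢ H ew₁ ∘ sym) (edge⇒≢ H ew₂ ∘ sym) w₂≢w₁
           (leafless-deg≥2 {G = G} leafless (subst (1 ≤_) (sym (sd w₁)) (edge⇒deg-pos H (edge-sym H ew₁))))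
           (leafless-deg≥2 {G = G} leafless (subst (1 ≤_) (sym (sd w₂)) (edge⇒deg-pos H (edge-sym H ew₂))))
  ... | G₂ , G→G₂ , sd₂ , e₁ , e₂ =
    reconfigurable-extend G→G₂ ε
      (reconfigure-two-edges G₂ H w₂≢w₁ (subst (_≤ suc k) (nonIsolated-sameDegrees {G = G} {G₂} sd₂) μ≤)
        (λ z → subst (_≤ 2) (sd₂ z) (deg≤2 z)) pfH (λ z → trans (sym (sd₂ z)) (sd z)) (trans (sym (sd₂ v)) dv) e₁ e₂ ew₁ ew₂)

reconfigure : ∀ {n} k → ReconfigurableBelow {n} k
reconfigure zero G H μ≤0 pfG pfH sd = G , ε , isolated⇒≅ (nonIsolated≤0⇒isolated G μ≤0) sd
reconfigure (suc k) G H μ≤ pfG pfH sd with any? (λ z → deg G z ≟ℕ 1)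
... | yes (v , dv) = leaf-case (reconfigure k) G H μ≤ pfG pfH sd dv
... | no no-leaf with any? (λ z → deg G z ≟ℕ 2)
... | yes (v , dv) = cycle-case (reconfigure k) G H μ≤ pfH sd deg≤2 leafless dv
  where
  leafless : Leafless G
  leafless z d≡1 = no-leaf (z , d≡1)
  deg≤2 : ∀ z → deg G z ≤ 2
  deg≤2 z = ≤-pred (≰⇒> (leafless⇒deg≤2 pfG leafless z))
... | no no-two = G , ε , isolated⇒≅ isolated sd
  where
  isolated : ∀ z → deg G z ≡ 0
  isolated z with deg G z in dz
  ... | zero = refl
  ... | suc zero = ⊥-elim (no-leaf (z , dz))
  ... | suc (suc zero) = ⊥-elim (no-two (z , dz))
  ... | suc (suc (suc _)) = ⊥-elim (leafless⇒deg≤2 pfG (λ y d≡1 → no-leaf (y , d≡1)) z (subst (3 ≤_) (sym dz) (s≤s (s≤s (s≤s z≤n)))))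

mainTheorem3 : ∀ (n : ℕ) (G H : Graph n) → Pseudoforest G → Pseudoforest H → SameDegrees G H →
    ∃[ K ] (Star PStep G K × SameGraph K H)
mainTheorem3 n G H pfG pfH sd with reconfigure (nonIsolated G) G H ≤-refl pfG pfH sd
... | K , G→K , K≅H = K , G→K , same-adj K≅H
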